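{- Let $n\ge 1$ and $\alpha\ge 1$ be integers, and fix one of the $\alpha$ colors, $\beta$. Then the $\alpha$-colored Eulerian polynomial satisfies $$A_n^{\alpha}(x)=\sum_{\tau\in\mathfrak{S}_{n,\beta}^\alpha}x^{d(\tau)}.$$
   Context: For $m\ge1$, $P_m$ denotes the permutohedron: the convex hull in $\mathbb{R}^m$ of all permutations of $(1,2,\dots,m)$, an $(m-1)$-dimensional polytope. Fix a set of $\alpha$ colors and a distinguished color $\beta$. An $\alpha$-colored ordered set partition of $[n]=\{1,\dots,n\}$ is a sequence $(B_1,\dots,B_k)$ of nonempty pairwise disjoint sets with union $[n]$, each block assigned one of the $\alpha$ colors, where the last block $B_k$ always has color $\beta$; its type is the composition $(|B_1|,\dots,|B_k|)$ of $n$. Call it alternating if consecutive blocks have different colors. The $\alpha$-colored permutohedron $P_n^\alpha$ is the polytopal complex which is the disjoint union, over all alternating $\alpha$-colored ordered set partitions $\tau$ of $[n]$, of a copy of $P_{c_1}\times\cdots\times P_{c_k}$, where $(c_1,\dots,c_k)$ is the type of $\tau$; its faces are the nonempty faces of these product polytopes. Let $f_d$ be the number of $d$-dimensional faces of $P_n^\alpha$. The $\alpha$-colored Eulerian polynomial is the $h$-polynomial $A_n^\alpha(t)=(1-t)^{n-1}f(t/(1-t))$ where $f(x)=\sum_{d=0}^{n-1}f_d\,x^{n-1-d}$; equivalently $A_n^\alpha(t)=\sum_{d=0}^{n-1}f_d\,t^{n-1-d}(1-t)^d$. An $\alpha$-colored permutation is a word $w_1^{c_1}\cdots w_n^{c_n}$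 with $w_1\cdots w_n\in\mathfrak{S}_n$ and each $c_i$ one of the $\alpha$ colors; $\mathfrak{S}_{n,\beta}^\alpha$ denotes the set of those with $c_n=\beta$. For such $\tau$, $d(\tau)=|\{i\in[n-1]: w_i>w_{i+1}\text{ or } c_i\neq c_{i+1}\}|$. -}

module Defs where

open import Data.Nat as ℕ using (ℕ; zero; suc; _<_; _∸_; _⊔_)
open import Data.Integer as ℤ using (ℤ; _*_; _-_; _^_)
open import Data.Fin using (Fin; toℕ)
open import Data.Fin.Properties using (_≟_)
open import Data.Vec using (Vec; lookup; toList; zip)
open import Data.List as List using (List; []; _∷_; map; allFin; foldr)
open import Data.Product using (∃; _×_; _,_)
open import Data.Bool using (if_then_else_)
open import Relation.Nullary using (¬_)
open import Relation.Nullary.Decidable using (⌊_⌋)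
open import Relation.Binary.PropositionalEquality using (_≡_; _≢_)

Σℤ : List ℤ → ℤ
Σℤ = foldr ℤ._+_ (ℤ.+ 0)

Σℕ : List ℕ → ℕ
Σℕ = foldr ℕ._+_ 0

-- A face is a pair (τ , (σ_1,…,σ_k)) where τ = (B_1,…,B_k) is an
-- alternating α-colored ordered set partition of [n] (last block has
-- color β) and σ_i is a face of the permutohedron P_{|B_i|} (on the
-- coordinate set B_i).  Faces of the permutohedron on a set B are
-- identified, as usual, with ordered set partitions of B; the face
-- labelled by an ordered set partition with m blocks has dimension
-- |B| - m.
--
-- Encoding (all data are vectors, all proof fields irrelevant, so that
-- propositional equality of faces is equality of the data):
--   blk x : the index (in Fin k) of the block of τ containing x,
--   col i : the color of the block B_i,
--   sub x : the index of the block of σ_{blk x} containing x; for each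
--           block B_i the used indices form an initial segment
--           {0,…,m_i - 1}, so σ_i is the ordered set partition of B_i
--           whose j-th block is {x ∈ B_i ∣ sub x = j}.

module _ {n k : ℕ} (blk : Vec (Fin k) n) where

  blockSize : Fin k → ℕ
  blockSize i = List.length (List.filter (λ x → lookup blk x ≟ i) (allFin n))

  -- m_i : the number of blocks of σ_i (= 1 + largest sub-index used in B_i)
  subBlocks : Vec (Fin n) n → Fin k → ℕ
  subBlocks sub i =
    foldr (λ x acc → if ⌊ lookup blk x ≟ i ⌋ then suc (toℕ (lookup sub x)) ⊔ acc else acc)
          0 (allFin n)

  faceDim : Vec (Fin n) n → ℕ
  faceDim sub = Σℕ (map (λ i → blockSize i ∸ subBlocks sub i) (allFin k))

record Face (n α : ℕ) (β : Fin α) (d : ℕ) : Set where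
  field
    k    : ℕ
    blk  : Vec (Fin k) n
    col  : Vec (Fin α) k
    sub  : Vec (Fin n) n
    .blk-surj : (i : Fin k) → ∃ λ x → lookup blk x ≡ i
    .alternating : (i j : Fin k) → toℕ j ≡ suc (toℕ i) → lookup col i ≢ lookup col j
    .last-β : (i : Fin k) → suc (toℕ i) ≡ k → lookup col i ≡ β
    .sub-init : (y : Fin n) (j : Fin n) → toℕ j < toℕ (lookup sub y) →
                ∃ λ z → lookup blk z ≡ lookup blk y × lookup sub z ≡ j
    .dim : faceDim blk sub ≡ d

-- "A has exactly N elements": a bijection Fin N ↔ A (with ≡ on both sides).

open import Function.Bundles using (_↔_) public

eulerianPoly : (n : ℕ) (f : ℕ → ℕ) → ℤ → ℤ
eulerianPoly n f x =
  Σℤ (map (λ d → ℤ.+ (f d) * (x ^ (n ∸ 1 ∸ d)) * ((ℤ.+ 1 - x) ^ d))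
          (List.upTo n))

record ColPerm (n α : ℕ) (β : Fin α) : Set where
  field
    word : Vec (Fin n) n
    cols : Vec (Fin α) n
    .word-inj : (i j : Fin n) → lookup word i ≡ lookup word j → i ≡ j
    .last-β : (i : Fin n) → suc (toℕ i) ≡ n → lookup cols i ≡ β

desList : {n α : ℕ} → List (Fin n × Fin α) → ℕ
desList [] = 0
desList (_ ∷ []) = 0
desList ((w , c) ∷ (w' , c') ∷ rest) =
  (if ⌊ toℕ w' ℕ.<? toℕ w ⌋ then 1 else (if ⌊ c ≟ c' ⌋ then 0 else 1))
  ℕ.+ desList ((w' , c') ∷ rest)

des : {n α : ℕ} {β : Fin α} → ColPerm n α β → ℕ
des τ = desList (toList (zip (ColPerm.word τ) (ColPerm.cols τ)))

{-# OPTIONS --safe #-}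
module Submission where

open import Defs
open import Data.Nat using (ℕ; _≤_)
open import Data.Integer using (ℤ; _^_)
open import Data.Fin using (Fin)
open import Data.List using (map; allFin)
open import Function.Bundles using (_↔_; Inverse)
open import Relation.Binary.PropositionalEquality using (_≡_)

-- By definition A(x) = Σ_F x^(n-1-dim F) (1-x)^(dim F), summed over all faces F of P_n^α.
-- Listing every sub-block of a face increasingly, in order, turns the face into a coloured
-- permutation τ together with the set S of positions i at which w_i and w_(i+1) lie in the same
-- sub-block. These positions are ascents of τ within one colour, and conversely every set S of
-- such "gluable" positions comes from exactly one face, of dimension |S|: cut τ at the other
-- positions and merge consecutive pieces of equal colour into blocks. Hence
--   A(x) = Σ_τ Σ_S x^(n-1-|S|) (1-x)^|S| = Σ_τ x^(n-1-g(τ)) (x + (1-x))^g(τ) = Σ_τ x^d(τ),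
-- where g(τ) is the number of gluable positions, whose complement is counted by d(τ).

module Lists where

  open import Data.Nat as ℕ using (ℕ; zero; suc; _<_; _≤_; z≤n; s≤s; _⊔_)
  import Data.Nat.Properties as ℕ
  open import Data.List as List using (List; []; _∷_; _++_; map; length; allFin; applyUpTo; concat)
  import Data.List.Properties as List
  open import Data.Maybe as Maybe using (Maybe; just; nothing)
  open import Data.Fin as Fin using (Fin; toℕ)
  import Data.Fin.Properties as Fin
  open import Data.Bool using (Bool; true; false; if_then_else_)
  open import Data.Product using (∃; _×_; _,_)
  open import Data.Sum using (_⊎_; inj₁; inj₂)
  open import Data.Unit using (⊤)
  open import Data.Empty using (⊥; ⊥-elim)
  open import Function using (_∘_)
  open import Function.Bundles using (_↔_; Inverse; mk⇔)
  open import Relation.Nullary using (Dec; yes; no)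
  open import Relation.Nullary.Decidable using (⌊_⌋; dec-true; isYes≗does)
  open import Relation.Binary.PropositionalEquality
  open import Data.List.Membership.Propositional using (_∈_)
  open import Data.List.Membership.Propositional.Properties using (∈-concat⁺′; ∈-lookup; ∈-allFin; ∈-map⁺)
  open import Data.List.Relation.Unary.Any as Any using (here; there)
  open import Data.List.Relation.Unary.All as All using (All; []; _∷_)
  import Data.List.Relation.Unary.All.Properties as All
  open import Data.List.Relation.Unary.AllPairs as AllPairs using (AllPairs; []; _∷_)
  import Data.List.Relation.Unary.AllPairs.Properties as AllPairs
  open import Data.List.Relation.Unary.Linked using (Linked; []; [-]; _∷_)
  open import Data.List.Relation.Unary.Linked.Properties using (AllPairs⇒Linked)
  open import Data.List.Relation.Unary.Unique.Propositional using (Unique)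
  import Data.List.Relation.Unary.Unique.Propositional.Properties as Unique
  import Data.List.Relation.Binary.Permutation.Propositional.Properties as Perm
  open import Data.List.Relation.Unary.Sorted.TotalOrder.Properties using (↗↭↗⇒≋)
  open import Data.List.Relation.Binary.Pointwise using (Pointwise-≡⇒≡)
  open import Data.List.Relation.Binary.Permutation.Propositional using (↭⇒↭ₛ)
  open import Data.List.Relation.Binary.BagAndSetEquality using (∼bag⇒↭)
  open import Data.List.Membership.Propositional.Properties.WithK using (unique∧set⇒bag)

  private variable
    A B : Set

  NonEmpty : List A → Set
  NonEmpty []      = ⊥
  NonEmpty (_ ∷ _) = ⊤

  ∈⇒NonEmpty : {x : A} {l : List A} → x ∈ l → NonEmpty l
  ∈⇒NonEmpty (here _)  = _
  ∈⇒NonEmpty (there _) = _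

  NonEmpty⇒∈ : (l : List A) → NonEmpty l → ∃ λ x → x ∈ l
  NonEmpty⇒∈ (x ∷ _) _ = x , here refl

  length≤length-concat : (ls : List (List A)) → All NonEmpty ls → length ls ≤ length (concat ls)
  length≤length-concat []             _        = z≤n
  length≤length-concat ((_ ∷ l) ∷ ls) (_ ∷ ne) = s≤s (begin
    length ls                       ≤⟨ length≤length-concat ls ne ⟩
    length (concat ls)              ≤⟨ ℕ.m≤n+m _ (length l) ⟩
    length l ℕ.+ length (concat ls) ≡⟨ List.length-++ l ⟨
    length (l ++ concat ls)         ∎)
    where open ℕ.≤-Reasoning

  data Last (P : A → Set) : List A → Set where
    end  : ∀ {x} → P x → Last P (x ∷ [])
    skip : ∀ {x y ys} → Last P (y ∷ ys) → Last P (x ∷ y ∷ ys)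

  module _ {X : Set} where

    Last-const⁺ : (l : List A) → NonEmpty l → X → Last (λ _ → X) l
    Last-const⁺ (_ ∷ [])    _ x = end x
    Last-const⁺ (_ ∷ y ∷ l) _ x = skip (Last-const⁺ (y ∷ l) _ x)

    Last-const⁻ : {l : List A} → Last (λ _ → X) l → X
    Last-const⁻ (end x)  = x
    Last-const⁻ (skip l) = Last-const⁻ l

  module _ {P : A → Set} where

    Last-++⁺ʳ : (xs : List A) {ys : List A} → Last P ys → Last P (xs ++ ys)
    Last-++⁺ʳ []            l          = l
    Last-++⁺ʳ (x ∷ [])      l@(end _)  = skip l
    Last-++⁺ʳ (x ∷ [])      l@(skip _) = skip l
    Last-++⁺ʳ (x ∷ x′ ∷ xs) l          = skip (Last-++⁺ʳ (x′ ∷ xs) l)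

    Last-++⁻ʳ : (xs : List A) {ys : List A} → NonEmpty ys → Last P (xs ++ ys) → Last P ys
    Last-++⁻ʳ []            _         l        = l
    Last-++⁻ʳ (x ∷ [])      {_ ∷ _} _ (skip l) = l
    Last-++⁻ʳ (x ∷ x′ ∷ xs) ne        (skip l) = Last-++⁻ʳ (x′ ∷ xs) ne l

    Last-tabulate⁺ : ∀ {k} (f : Fin (suc k) → A) → (∀ i → suc (toℕ i) ≡ suc k → P (f i)) →
      Last P (List.tabulate f)
    Last-tabulate⁺ {zero}  f h = end (h Fin.zero refl)
    Last-tabulate⁺ {suc k} f h = skip (Last-tabulate⁺ (f ∘ Fin.suc) (λ i e → h (Fin.suc i) (cong suc e)))

  module _ {P : B → Set} (f : A → B) where

    Last-map⁺ : (l : List A) → Last (P ∘ f) l → Last P (map f l)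
    Last-map⁺ (x ∷ [])    (end p)  = end p
    Last-map⁺ (x ∷ y ∷ l) (skip q) = skip (Last-map⁺ (y ∷ l) q)

    Last-map⁻ : (l : List A) → Last P (map f l) → Last (P ∘ f) l
    Last-map⁻ (x ∷ [])    (end p)  = end p
    Last-map⁻ (x ∷ y ∷ l) (skip q) = skip (Last-map⁻ (y ∷ l) q)

  Linked-tabulate⁺ : {R : A → A → Set} {k : ℕ} (f : Fin k → A) →
    (∀ i j → toℕ j ≡ suc (toℕ i) → R (f i) (f j)) → Linked R (List.tabulate f)
  Linked-tabulate⁺ {k = zero}        f h = []
  Linked-tabulate⁺ {k = suc zero}    f h = [-]
  Linked-tabulate⁺ {k = suc (suc k)} f h =
    h Fin.zero (Fin.suc Fin.zero) refl ∷
    Linked-tabulate⁺ (f ∘ Fin.suc) (λ i j e → h (Fin.suc i) (Fin.suc j) (cong suc e))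

  nth : List A → ℕ → Maybe A
  nth []      _       = nothing
  nth (a ∷ l) zero    = just a
  nth (a ∷ l) (suc i) = nth l i

  nth-map : (f : A → B) (l : List A) (i : ℕ) → nth (map f l) i ≡ Maybe.map f (nth l i)
  nth-map f []      i       = refl
  nth-map f (a ∷ l) zero    = refl
  nth-map f (a ∷ l) (suc i) = nth-map f l i

  nth-applyUpTo : (f : ℕ → A) {m i : ℕ} → i < m → nth (applyUpTo f m) i ≡ just (f i)
  nth-applyUpTo f {suc m} {zero}  _       = refl
  nth-applyUpTo f {suc m} {suc i} (s≤s p) = nth-applyUpTo (f ∘ suc) p

  nth-tabulate : ∀ {k} (f : Fin k → A) (i : Fin k) → nth (List.tabulate f) (toℕ i) ≡ just (f i)
  nth-tabulate f Fin.zero    = refl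
  nth-tabulate f (Fin.suc i) = nth-tabulate (f ∘ Fin.suc) i

  nth-< : (l : List A) {i : ℕ} → i < length l → ∃ λ a → nth l i ≡ just a
  nth-< (a ∷ l) {zero}  _       = a , refl
  nth-< (a ∷ l) {suc i} (s≤s p) = nth-< l p

  nth≡just⇒< : (l : List A) (i : ℕ) {a : A} → nth l i ≡ just a → i < length l
  nth≡just⇒< (a ∷ l) zero    _ = s≤s z≤n
  nth≡just⇒< (a ∷ l) (suc i) e = s≤s (nth≡just⇒< l i e)

  nth≡just⇒∈ : (l : List A) (i : ℕ) {a : A} → nth l i ≡ just a → a ∈ l
  nth≡just⇒∈ (a ∷ l) zero    refl = here refl
  nth≡just⇒∈ (a ∷ l) (suc i) e    = there (nth≡just⇒∈ l i e)

  ∈⇒nth≡just : {l : List A} {a : A} → a ∈ l → ∃ λ i → nth l i ≡ just a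
  ∈⇒nth≡just (here refl) = zero , refl
  ∈⇒nth≡just (there a∈)  = let i , e = ∈⇒nth≡just a∈ in suc i , e

  Linked-nth : {R : A → A → Set} (l : List A) (i : ℕ) {a a′ : A} → Linked R l →
    nth l i ≡ just a → nth l (suc i) ≡ just a′ → R a a′
  Linked-nth (a ∷ a′ ∷ l) zero    (r ∷ _)  refl refl = r
  Linked-nth (a ∷ a′ ∷ l) (suc i) (_ ∷ rs) e₁   e₂   = Linked-nth (a′ ∷ l) i rs e₁ e₂

  Last-nth : {P : A → Set} (l : List A) {a : A} → Last P l → nth l (length l ℕ.∸ 1) ≡ just a → P a
  Last-nth (a ∷ [])     (end p)  refl = p
  Last-nth (a ∷ a′ ∷ l) (skip q) e    = Last-nth (a′ ∷ l) q e

  tabulate≡map : (l : List B) {k : ℕ} → length l ≡ k → (g : Fin k → A) (h : B → A) →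
    (∀ i {b} → nth l (toℕ i) ≡ just b → g i ≡ h b) → List.tabulate g ≡ map h l
  tabulate≡map []      {zero}  _   g h e = refl
  tabulate≡map (b ∷ l) {suc k} len g h e =
    cong₂ _∷_ (e Fin.zero refl) (tabulate≡map l (ℕ.suc-injective len) (g ∘ Fin.suc) h (e ∘ Fin.suc))

  applyUpTo-length≡ : (l : List A) (g : ℕ → A) → (∀ j {a} → nth l j ≡ just a → g j ≡ a) →
    applyUpTo g (length l) ≡ l
  applyUpTo-length≡ []      g h = refl
  applyUpTo-length≡ (a ∷ l) g h = cong₂ _∷_ (h zero refl) (applyUpTo-length≡ l (g ∘ suc) (h ∘ suc))

  findIndex : (A → Bool) → List A → ℕ
  findIndex p []      = 0
  findIndex p (a ∷ l) = if p a then 0 else suc (findIndex p l)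

  findIndex-nth : (p : A → Bool) (l : List A) (i : ℕ) {a : A} → nth l i ≡ just a → p a ≡ true →
    (∀ i′ {a′} → i′ < i → nth l i′ ≡ just a′ → p a′ ≡ false) → findIndex p l ≡ i
  findIndex-nth p (a ∷ l) zero    refl pa _ rewrite pa = refl
  findIndex-nth p (b ∷ l) (suc i) e    pa before rewrite before zero (s≤s z≤n) refl =
    cong suc (findIndex-nth p l i e pa (λ i′ lt → before (suc i′) (s≤s lt)))

  module _ {R : A → A → Set} where

    AllPairs-++⁻ʳ : (xs : List A) {ys : List A} → AllPairs R (xs ++ ys) → AllPairs R ys
    AllPairs-++⁻ʳ []       p       = p
    AllPairs-++⁻ʳ (x ∷ xs) (_ ∷ p) = AllPairs-++⁻ʳ xs p

    AllPairs-++⁻ˡ : (xs : List A) {ys : List A} → AllPairs R (xs ++ ys) → AllPairs R xs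
    AllPairs-++⁻ˡ []       p       = []
    AllPairs-++⁻ˡ (x ∷ xs) (r ∷ p) = All.++⁻ˡ xs r ∷ AllPairs-++⁻ˡ xs p

    AllPairs-++⁻-across : (xs : List A) {ys : List A} → AllPairs R (xs ++ ys) →
      ∀ {x y} → x ∈ xs → y ∈ ys → R x y
    AllPairs-++⁻-across (x ∷ xs) (r ∷ p) (here refl) y∈ = All.lookup (All.++⁻ʳ xs r) y∈
    AllPairs-++⁻-across (x ∷ xs) (r ∷ p) (there x∈) y∈ = AllPairs-++⁻-across xs p x∈ y∈

  Unique-concat⁻ : (ls : List (List A)) → Unique (concat ls) → ∀ i {l} → nth ls i ≡ just l → Unique l
  Unique-concat⁻ (l ∷ ls) u zero    refl = AllPairs-++⁻ˡ l u
  Unique-concat⁻ (l ∷ ls) u (suc i) e    = Unique-concat⁻ ls (AllPairs-++⁻ʳ l u) i e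

  Unique-concat-index : (ls : List (List A)) → Unique (concat ls) → ∀ i j {l₁ l₂ x} →
    nth ls i ≡ just l₁ → nth ls j ≡ just l₂ → x ∈ l₁ → x ∈ l₂ → i ≡ j
  Unique-concat-index (l ∷ ls) u zero    zero    _    _    _   _   = refl
  Unique-concat-index (l ∷ ls) u zero    (suc j) refl e₂   x∈₁ x∈₂ =
    ⊥-elim (AllPairs-++⁻-across l u x∈₁ (∈-concat⁺′ x∈₂ (nth≡just⇒∈ ls j e₂)) refl)
  Unique-concat-index (l ∷ ls) u (suc i) zero    e₁   refl x∈₁ x∈₂ =
    ⊥-elim (AllPairs-++⁻-across l u x∈₂ (∈-concat⁺′ x∈₁ (nth≡just⇒∈ ls i e₁)) refl)
  Unique-concat-index (l ∷ ls) u (suc i) (suc j) e₁   e₂   x∈₁ x∈₂ =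
    cong suc (Unique-concat-index ls (AllPairs-++⁻ʳ l u) i j e₁ e₂ x∈₁ x∈₂)

  length-nth≤length-concat : (ls : List (List A)) (i : ℕ) {l : List A} → nth ls i ≡ just l →
    length l ≤ length (concat ls)
  length-nth≤length-concat (l ∷ ls) zero    refl = subst (length l ≤_) (sym (List.length-++ l)) (ℕ.m≤m+n _ _)
  length-nth≤length-concat (l ∷ ls) (suc i) e    = ℕ.≤-trans (length-nth≤length-concat ls i e)
    (subst (length (concat ls) ≤_) (sym (List.length-++ l)) (ℕ.m≤n+m _ _))

  Unique⇒lookup-injective : (l : List A) → Unique l → ∀ i j → List.lookup l i ≡ List.lookup l j → i ≡ j
  Unique⇒lookup-injective (a ∷ l) u        Fin.zero    Fin.zero    e = refl
  Unique⇒lookup-injective (a ∷ l) (a∉ ∷ u) Fin.zero    (Fin.suc j) e = ⊥-elim (All.lookup a∉ (∈-lookup j) e)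
  Unique⇒lookup-injective (a ∷ l) (a∉ ∷ u) (Fin.suc i) Fin.zero    e = ⊥-elim (All.lookup a∉ (∈-lookup i) (sym e))
  Unique⇒lookup-injective (a ∷ l) (_ ∷ u)  (Fin.suc i) (Fin.suc j) e =
    cong Fin.suc (Unique⇒lookup-injective l u i j e)

  Unique⇒length≤ : ∀ {m} (l : List (Fin m)) → Unique l → length l ≤ m
  Unique⇒length≤ {m} l u with length l ℕ.≤? m
  ... | yes p = p
  ... | no ¬p with Fin.pigeonhole (ℕ.≰⇒> ¬p) (List.lookup l)
  ...   | i , j , i<j , e = ⊥-elim (Fin.<⇒≢ i<j (Unique⇒lookup-injective l u i j e))

  Unique∧length≡⇒complete : ∀ {m} (l : List (Fin m)) → Unique l → length l ≡ m → ∀ x → x ∈ l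
  Unique∧length≡⇒complete {m} l u len x with Any.any? (x Fin.≟_) l
  ... | yes x∈ = x∈
  ... | no x∉  = ⊥-elim (ℕ.<-irrefl refl
    (subst (suc (length l) ≤_) (sym len) (Unique⇒length≤ (x ∷ l) (All.¬Any⇒All¬ l x∉ ∷ u))))

  Unique∧complete⇒length≡ : ∀ {m} (l : List (Fin m)) → Unique l → (∀ x → x ∈ l) → length l ≡ m
  Unique∧complete⇒length≡ {m} l u complete =
    trans (Perm.↭-length (∼bag⇒↭ (unique∧set⇒bag u (Unique.allFin⁺ m)
             (λ {x} → mk⇔ (λ _ → ∈-allFin x) (λ _ → complete x)))))
          (List.length-tabulate {n = m} (λ i → i))

  ∈-enumeration : ∀ {m} (g : Fin m ↔ A) (y : A) → y ∈ map (Inverse.to g) (allFin m)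
  ∈-enumeration g y =
    subst (_∈ _) (Inverse.strictlyInverseˡ g y) (∈-map⁺ (Inverse.to g) (∈-allFin (Inverse.from g y)))

  Increasing : ∀ {m} → List (Fin m) → Set
  Increasing = AllPairs Fin._<_

  Increasing⇒Unique : ∀ {m} {l : List (Fin m)} → Increasing l → Unique l
  Increasing⇒Unique = AllPairs.map Fin.<⇒≢

  allFin-increasing : ∀ m → Increasing (allFin m)
  allFin-increasing m = AllPairs.tabulate⁺-< (λ i<j → i<j)

  Increasing-≡ : ∀ {m} {xs ys : List (Fin m)} → Increasing xs → Increasing ys →
    (∀ {x} → x ∈ xs → x ∈ ys) → (∀ {x} → x ∈ ys → x ∈ xs) → xs ≡ ys
  Increasing-≡ {m} xs↗ ys↗ xs⊆ys ys⊆xs =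
    Pointwise-≡⇒≡ (↗↭↗⇒≋ (Fin.≤-totalOrder m) (weaken xs↗) (weaken ys↗)
      (↭⇒↭ₛ (∼bag⇒↭ (unique∧set⇒bag (Increasing⇒Unique xs↗) (Increasing⇒Unique ys↗)
                                     (mk⇔ xs⊆ys ys⊆xs)))))
    where
    weaken : ∀ {l} → Increasing l → Linked Fin._≤_ l
    weaken = AllPairs⇒Linked ∘ AllPairs.map ℕ.<⇒≤

  clamp : (k : ℕ) → ℕ → Fin (suc k)
  clamp zero    _       = Fin.zero
  clamp (suc k) zero    = Fin.zero
  clamp (suc k) (suc i) = Fin.suc (clamp k i)

  toℕ-clamp : ∀ k {i} → i ≤ k → toℕ (clamp k i) ≡ i
  toℕ-clamp zero    {zero}  _       = refl
  toℕ-clamp (suc k) {zero}  _       = refl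
  toℕ-clamp (suc k) {suc i} (s≤s p) = cong suc (toℕ-clamp k p)

  clamp-toℕ : ∀ k (i : Fin (suc k)) → clamp k (toℕ i) ≡ i
  clamp-toℕ k i = Fin.toℕ-injective (toℕ-clamp k (ℕ.≤-pred (Fin.toℕ<n i)))

  ⌊⌋≡true⇒ : {A : Set} (d : Dec A) → ⌊ d ⌋ ≡ true → A
  ⌊⌋≡true⇒ (yes a) _ = a

  ⌊⌋≡true⁺ : {A : Set} (d : Dec A) → A → ⌊ d ⌋ ≡ true
  ⌊⌋≡true⁺ d a = trans (isYes≗does d) (dec-true d a)

  -- Defs.subBlocks blk sub i unfolds to maxOver (λ x → ⌊ lookup blk x ≟ i ⌋) (λ x → suc (toℕ (lookup sub x))) (allFin n).
  module _ {A : Set} (P : A → Bool) (g : A → ℕ) where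

    maxOver : List A → ℕ
    maxOver = List.foldr (λ x acc → if P x then g x ⊔ acc else acc) 0

    maxOver-≤ : ∀ l {M} → (∀ x → x ∈ l → P x ≡ true → g x ≤ M) → maxOver l ≤ M
    maxOver-≤ []      h = z≤n
    maxOver-≤ (x ∷ l) h with P x in px
    ... | true  = ℕ.⊔-lub (h x (here refl) px) (maxOver-≤ l (λ y → h y ∘ there))
    ... | false = maxOver-≤ l (λ y → h y ∘ there)

    ≤-maxOver : ∀ l {x} → x ∈ l → P x ≡ true → g x ≤ maxOver l
    ≤-maxOver (y ∷ l) (here refl) px rewrite px = ℕ.m≤m⊔n _ _
    ≤-maxOver (y ∷ l) (there x∈)  px with P y
    ... | true  = ℕ.≤-trans (≤-maxOver l x∈ px) (ℕ.m≤n⊔m _ _)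
    ... | false = ≤-maxOver l x∈ px

    maxOver-attained : ∀ l → maxOver l ≡ 0 ⊎ ∃ λ x → x ∈ l × P x ≡ true × g x ≡ maxOver l
    maxOver-attained []      = inj₁ refl
    maxOver-attained (x ∷ l) with P x in px
    ... | false with maxOver-attained l
    ...   | inj₁ z                   = inj₁ z
    ...   | inj₂ (y , y∈ , py , gy) = inj₂ (y , there y∈ , py , gy)
    maxOver-attained (x ∷ l) | true with ℕ.⊔-sel (g x) (maxOver l)
    ...   | inj₁ e = inj₂ (x , here refl , px , sym e)
    ...   | inj₂ e with maxOver-attained l
    ...     | inj₁ z                   =
      inj₂ (x , here refl , px , sym (trans (cong (g x ⊔_) z) (ℕ.⊔-identityʳ (g x))))
    ...     | inj₂ (y , y∈ , py , gy) = inj₂ (y , there y∈ , py , trans gy (sym e))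

module IntegerSums where

  open import Defs using (Σℤ)
  open import Data.Integer using (ℤ; +_; _+_; _*_)
  import Data.Integer.Properties as ℤ
  open import Data.List using (List; []; _∷_; _++_; map; concatMap; length)
  import Data.List.Properties as List
  open import Data.List.Relation.Binary.Permutation.Propositional using (_↭_; ↭⇒↭ₛ)
  open import Data.List.Relation.Binary.Permutation.Setoid.Properties using (foldr-commMonoid)
  open import Data.List.Membership.Propositional using (_∈_)
  open import Data.List.Membership.Propositional.Properties using (∈-++⁺ˡ; ∈-++⁺ʳ; ∈-++⁻; ∈-map⁺; ∈-map⁻)
  open import Data.List.Relation.Unary.Any using (here; there)
  import Data.List.Relation.Unary.All.Properties as All
  open import Data.List.Relation.Unary.Unique.Propositional using (Unique; []; _∷_)
  import Data.List.Relation.Unary.Unique.Propositional.Properties as Unique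
  open import Data.Product using (Σ; _×_; _,_; proj₁)
  open import Data.Sum using (inj₁; inj₂)
  open import Data.Empty using (⊥)
  open import Function using (_∘_)
  open import Relation.Binary.PropositionalEquality

  Σℤ-++ : (xs ys : List ℤ) → Σℤ (xs ++ ys) ≡ Σℤ xs + Σℤ ys
  Σℤ-++ []       ys = sym (ℤ.+-identityˡ _)
  Σℤ-++ (x ∷ xs) ys = trans (cong (_+_ x) (Σℤ-++ xs ys)) (sym (ℤ.+-assoc x _ _))

  Σℤ-↭ : {xs ys : List ℤ} → xs ↭ ys → Σℤ xs ≡ Σℤ ys
  Σℤ-↭ p = foldr-commMonoid (setoid ℤ) ℤ.+-0-isCommutativeMonoid (↭⇒↭ₛ p)

  module _ {A : Set} where

    Σℤ-map-∘ : {B : Set} (g : B → ℤ) (f : A → B) (l : List A) →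
      Σℤ (map g (map f l)) ≡ Σℤ (map (g ∘ f) l)
    Σℤ-map-∘ g f l = cong Σℤ (sym (List.map-∘ l))

    Σℤ-*ˡ : (a : ℤ) (g : A → ℤ) (l : List A) → Σℤ (map (λ s → a * g s) l) ≡ a * Σℤ (map g l)
    Σℤ-*ˡ a g []      = sym (ℤ.*-zeroʳ a)
    Σℤ-*ˡ a g (s ∷ l) = trans (cong (_+_ (a * g s)) (Σℤ-*ˡ a g l)) (sym (ℤ.*-distribˡ-+ a _ _))

    Σℤ-const : (c : ℤ) (l : List A) → Σℤ (map (λ _ → c) l) ≡ + length l * c
    Σℤ-const c l = begin
      Σℤ (map (λ _ → c) l)         ≡⟨ cong Σℤ (List.map-cong (λ _ → sym (ℤ.*-identityʳ c)) l) ⟩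
      Σℤ (map (λ _ → c * + 1) l)   ≡⟨ Σℤ-*ˡ c (λ _ → + 1) l ⟩
      c * Σℤ (map (λ _ → + 1) l)   ≡⟨ cong (c *_) (Σℤ-ones l) ⟩
      c * + length l               ≡⟨ ℤ.*-comm c _ ⟩
      + length l * c               ∎
      where
      open ≡-Reasoning
      Σℤ-ones : (l : List A) → Σℤ (map (λ _ → + 1) l) ≡ + length l
      Σℤ-ones []      = refl
      Σℤ-ones (_ ∷ l) = cong (_+_ (+ 1)) (Σℤ-ones l)

  module _ {A : Set} {B : A → Set} where

    Σ-list : List A → ((a : A) → List (B a)) → List (Σ A B)
    Σ-list l h = concatMap (λ a → map (a ,_) (h a)) l

    Σℤ-Σ-list : (g : Σ A B → ℤ) (l : List A) (h : (a : A) → List (B a)) →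
      Σℤ (map g (Σ-list l h)) ≡ Σℤ (map (λ a → Σℤ (map (λ b → g (a , b)) (h a))) l)
    Σℤ-Σ-list g []      h = refl
    Σℤ-Σ-list g (a ∷ l) h = begin
      Σℤ (map g (map (a ,_) (h a) ++ Σ-list l h))
        ≡⟨ cong Σℤ (List.map-++ g (map (a ,_) (h a)) (Σ-list l h)) ⟩
      Σℤ (map g (map (a ,_) (h a)) ++ map g (Σ-list l h))
        ≡⟨ Σℤ-++ (map g (map (a ,_) (h a))) (map g (Σ-list l h)) ⟩
      Σℤ (map g (map (a ,_) (h a))) + Σℤ (map g (Σ-list l h))
        ≡⟨ cong₂ _+_ (Σℤ-map-∘ g (a ,_) (h a)) (Σℤ-Σ-list g l h) ⟩
      Σℤ (map (λ b → g (a , b)) (h a)) + Σℤ (map (λ a → Σℤ (map (λ b → g (a , b)) (h a))) l) ∎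
      where open ≡-Reasoning

    ∈-Σ-list⁺ : {l : List A} {h : (a : A) → List (B a)} {a : A} {b : B a} →
      a ∈ l → b ∈ h a → (a , b) ∈ Σ-list l h
    ∈-Σ-list⁺ {a′ ∷ l} {h} (here refl) b∈ = ∈-++⁺ˡ (∈-map⁺ (a′ ,_) b∈)
    ∈-Σ-list⁺ {a′ ∷ l} {h} (there a∈)  b∈ = ∈-++⁺ʳ (map (a′ ,_) (h a′)) (∈-Σ-list⁺ a∈ b∈)

    ∈-Σ-list⁻ : (l : List A) (h : (a : A) → List (B a)) {a : A} {b : B a} →
      (a , b) ∈ Σ-list l h → a ∈ l × b ∈ h a
    ∈-Σ-list⁻ (a′ ∷ l) h ab∈ with ∈-++⁻ (map (a′ ,_) (h a′)) ab∈
    ... | inj₂ ab∈′ = let a∈ , b∈ = ∈-Σ-list⁻ l h ab∈′ in there a∈ , b∈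
    ... | inj₁ ab∈′ with ∈-map⁻ (a′ ,_) ab∈′
    ...   | _ , b∈ , refl = here refl , b∈

    Σ-list-unique : (l : List A) (h : (a : A) → List (B a)) →
      Unique l → (∀ a → Unique (h a)) → Unique (Σ-list l h)
    Σ-list-unique []      h _          _  = []
    Σ-list-unique (a ∷ l) h (a∉l ∷ ul) uh =
      Unique.++⁺ (Unique.map⁺ ,-injectiveʳ (uh a)) (Σ-list-unique l h ul uh) disjoint
      where
      ,-injectiveʳ : {b b′ : B a} → (a , b) ≡ (a , b′) → b ≡ b′
      ,-injectiveʳ refl = refl
      disjoint : ∀ {t} → t ∈ map (a ,_) (h a) × t ∈ Σ-list l h → ⊥
      disjoint (t∈₁ , t∈₂) with ∈-map⁻ (a ,_) t∈₁
      ... | _ , _ , refl = All.All¬⇒¬Any a∉l (proj₁ (∈-Σ-list⁻ l h t∈₂))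

module Gluings where

  open import Defs using (Σℤ; desList)
  open IntegerSums
  open import Data.Nat as ℕ using (ℕ; suc; _∸_; _≤_; _<_)
  import Data.Nat.Properties as ℕ
  open import Data.Integer using (ℤ; +_; _+_; _*_; _-_; _^_)
  import Data.Integer.Properties as ℤ
  open import Data.Integer.Tactic.RingSolver using (solve-∀)
  open import Data.List using (List; []; _∷_; _++_; map; length)
  import Data.List.Properties as List
  open import Data.List.Membership.Propositional using (_∈_)
  open import Data.List.Membership.Propositional.Properties using (∈-++⁺ˡ; ∈-++⁺ʳ; ∈-++⁻; ∈-map⁺; ∈-map⁻)
  open import Data.List.Relation.Unary.Any using (here)
  open import Data.List.Relation.Unary.All using ([])
  open import Data.List.Relation.Unary.Unique.Propositional using (Unique; []; _∷_)
  import Data.List.Relation.Unary.Unique.Propositional.Properties as Unique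
  open import Data.List.Relation.Binary.Disjoint.Propositional using (Disjoint)
  open import Data.Fin as Fin using (Fin; toℕ)
  import Data.Fin.Properties as Fin
  open import Data.Bool using (Bool; true; false; if_then_else_)
  open import Data.Product using (_×_; _,_; proj₁; proj₂)
  open import Data.Sum using (inj₁; inj₂)
  open import Data.Empty using (⊥-elim)
  open import Relation.Nullary using (¬_; yes; no)
  open import Relation.Nullary.Decidable using (⌊_⌋)
  open import Function using (_∘_)
  open import Relation.Binary.PropositionalEquality

  trues : List Bool → ℕ
  trues []           = 0
  trues (true ∷ bs)  = suc (trues bs)
  trues (false ∷ bs) = trues bs

  trues≤length : ∀ bs → trues bs ≤ length bs
  trues≤length []           = ℕ.z≤n
  trues≤length (true ∷ bs)  = ℕ.s≤s (trues≤length bs)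
  trues≤length (false ∷ bs) = ℕ.m≤n⇒m≤1+n (trues≤length bs)

  trues-++ : ∀ xs ys → trues (xs ++ ys) ≡ trues xs ℕ.+ trues ys
  trues-++ []           ys = refl
  trues-++ (true ∷ xs)  ys = cong suc (trues-++ xs ys)
  trues-++ (false ∷ xs) ys = trues-++ xs ys

  module _ (x : ℤ) where

    weight : List Bool → ℤ
    weight []       = + 1
    weight (b ∷ bs) = (if b then + 1 - x else x) * weight bs

    weight-closed : ∀ bs → weight bs ≡ x ^ (length bs ∸ trues bs) * (+ 1 - x) ^ trues bs
    weight-closed [] = refl
    weight-closed (true ∷ bs) = begin
      (+ 1 - x) * weight bs                             ≡⟨ cong ((+ 1 - x) *_) (weight-closed bs) ⟩
      (+ 1 - x) * (x ^ (length bs ∸ t) * (+ 1 - x) ^ t) ≡⟨ exchange (+ 1 - x) (x ^ (length bs ∸ t)) _ ⟩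
      x ^ (length bs ∸ t) * ((+ 1 - x) * (+ 1 - x) ^ t) ∎
      where
      open ≡-Reasoning
      t : ℕ
      t = trues bs
      exchange : ∀ (a b c : ℤ) → a * (b * c) ≡ b * (a * c)
      exchange = solve-∀
    weight-closed (false ∷ bs) = begin
      x * weight bs                             ≡⟨ cong (x *_) (weight-closed bs) ⟩
      x * (x ^ (length bs ∸ t) * (+ 1 - x) ^ t) ≡⟨ ℤ.*-assoc x _ _ ⟨
      x * x ^ (length bs ∸ t) * (+ 1 - x) ^ t
        ≡⟨ cong (λ k → x ^ k * (+ 1 - x) ^ t) (ℕ.+-∸-assoc 1 (trues≤length bs)) ⟨
      x ^ (suc (length bs) ∸ t) * (+ 1 - x) ^ t ∎
      where
      open ≡-Reasoning
      t : ℕ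
      t = trues bs

  module _ {n α : ℕ} where

    Letter : Set
    Letter = Fin n × Fin α

    gluable : Letter → Letter → Bool
    gluable (w , c) (w′ , c′) = if ⌊ toℕ w′ ℕ.<? toℕ w ⌋ then false else ⌊ c Fin.≟ c′ ⌋

    gluable⇒≡colour : ∀ (p q : Letter) → gluable p q ≡ true → proj₂ p ≡ proj₂ q
    gluable⇒≡colour (w , c) (w′ , c′) eq with toℕ w′ ℕ.<? toℕ w | c Fin.≟ c′
    gluable⇒≡colour (w , c) (w′ , c′) () | yes _ | _
    gluable⇒≡colour (w , c) (w′ , c′) _  | no _  | yes c≡c′ = c≡c′
    gluable⇒≡colour (w , c) (w′ , c′) () | no _  | no _

    gluable⇒≯ : ∀ (p q : Letter) → gluable p q ≡ true → ¬ (toℕ (proj₁ q) < toℕ (proj₁ p))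
    gluable⇒≯ (w , c) (w′ , c′) eq with toℕ w′ ℕ.<? toℕ w
    gluable⇒≯ (w , c) (w′ , c′) () | yes _
    gluable⇒≯ (w , c) (w′ , c′) _  | no w′≮w = w′≮w

    <⇒gluable : ∀ {e e′ : Fin n} (c : Fin α) → e Fin.< e′ → gluable (e , c) (e′ , c) ≡ true
    <⇒gluable {e} {e′} c e<e′ with toℕ e′ ℕ.<? toℕ e | c Fin.≟ c
    ... | yes e′<e | _      = ⊥-elim (ℕ.<-asym e<e′ e′<e)
    ... | no _     | yes _  = refl
    ... | no _     | no c≢c = ⊥-elim (c≢c refl)

    gluable∧≢⇒< : ∀ (p q : Letter) → gluable p q ≡ true → proj₁ p ≢ proj₁ q → proj₁ p Fin.< proj₁ q
    gluable∧≢⇒< p q pq p≢q = ℕ.≤∧≢⇒< (ℕ.≮⇒≥ (gluable⇒≯ p q pq)) (p≢q ∘ Fin.toℕ-injective)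

    data Gluing : List Letter → List Bool → Set where
      []   : Gluing [] []
      [-]  : ∀ {p} → Gluing (p ∷ []) []
      cut  : ∀ {p q r S} → Gluing (q ∷ r) S → Gluing (p ∷ q ∷ r) (false ∷ S)
      glue : ∀ {p q r S} → gluable p q ≡ true → Gluing (q ∷ r) S → Gluing (p ∷ q ∷ r) (true ∷ S)

    Gluing-length : ∀ {L S} → Gluing L S → length S ≡ length L ∸ 1
    Gluing-length []         = refl
    Gluing-length [-]        = refl
    Gluing-length (cut g)    = cong suc (Gluing-length g)
    Gluing-length (glue _ g) = cong suc (Gluing-length g)

    gluings : List Letter → List (List Bool)
    gluings []          = [] ∷ []
    gluings (_ ∷ [])    = [] ∷ []
    gluings (p ∷ q ∷ r) = map (false ∷_) (gluings (q ∷ r))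
                       ++ (if gluable p q then map (true ∷_) (gluings (q ∷ r)) else [])

    Gluing⇒∈gluings : ∀ {L S} → Gluing L S → S ∈ gluings L
    Gluing⇒∈gluings []      = here refl
    Gluing⇒∈gluings [-]     = here refl
    Gluing⇒∈gluings (cut g) = ∈-++⁺ˡ (∈-map⁺ (false ∷_) (Gluing⇒∈gluings g))
    Gluing⇒∈gluings {p ∷ q ∷ r} (glue {S = S} pq g) =
      ∈-++⁺ʳ (map (false ∷_) (gluings (q ∷ r)))
        (subst (λ b → true ∷ S ∈ (if b then map (true ∷_) (gluings (q ∷ r)) else [])) (sym pq)
          (∈-map⁺ (true ∷_) (Gluing⇒∈gluings g)))

    ∈gluings⇒Gluing : ∀ L {S} → S ∈ gluings L → Gluing L S
    ∈gluings⇒Gluing [] (here refl)       = []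
    ∈gluings⇒Gluing (_ ∷ []) (here refl) = [-]
    ∈gluings⇒Gluing (p ∷ q ∷ r) S∈ with ∈-++⁻ (map (false ∷_) (gluings (q ∷ r))) S∈
    ... | inj₁ S∈′ with ∈-map⁻ (false ∷_) S∈′
    ...   | _ , S∈″ , refl = cut (∈gluings⇒Gluing (q ∷ r) S∈″)
    ∈gluings⇒Gluing (p ∷ q ∷ r) S∈ | inj₂ S∈′ with gluable p q in pq
    ... | true with ∈-map⁻ (true ∷_) S∈′
    ...   | _ , S∈″ , refl = glue pq (∈gluings⇒Gluing (q ∷ r) S∈″)

    gluings-unique : ∀ L → Unique (gluings L)
    gluings-unique []          = [] ∷ []
    gluings-unique (_ ∷ [])    = [] ∷ []
    gluings-unique (p ∷ q ∷ r) =
      Unique.++⁺ (Unique.map⁺ List.∷-injectiveʳ (gluings-unique (q ∷ r)))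
                 (glued-unique (gluable p q) (gluings-unique (q ∷ r)))
                 (disjoint (gluable p q))
      where
      glued-unique : ∀ b {s} → Unique s → Unique (if b then map (true ∷_) s else [])
      glued-unique true  u = Unique.map⁺ List.∷-injectiveʳ u
      glued-unique false _ = []
      disjoint : ∀ b {s} → Disjoint (map (false ∷_) s) (if b then map (true ∷_) s else [])
      disjoint true (S∈₁ , S∈₂) with ∈-map⁻ (false ∷_) S∈₁ | ∈-map⁻ (true ∷_) S∈₂
      ... | _ , _ , refl | _ , _ , ()

    ^-desList-∷∷ : ∀ x p q r →
      x ^ desList (p ∷ q ∷ r) ≡ (if gluable p q then + 1 else x) * x ^ desList (q ∷ r)
    ^-desList-∷∷ x (w , c) (w′ , c′) r with toℕ w′ ℕ.<? toℕ w | c Fin.≟ c′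
    ... | yes _ | _     = refl
    ... | no _  | yes _ = sym (ℤ.*-identityˡ _)
    ... | no _  | no _  = refl

    -- A glued pair contributes (1 - x) + x = 1, any other pair contributes x.
    Σ-weight-extend : ∀ x b (s : List (List Bool)) →
      Σℤ (map (weight x) (map (false ∷_) s ++ (if b then map (true ∷_) s else [])))
        ≡ (if b then + 1 else x) * Σℤ (map (weight x) s)
    Σ-weight-extend x false s = begin
      Σℤ (map (weight x) (map (false ∷_) s ++ []))
        ≡⟨ cong (Σℤ ∘ map (weight x)) (List.++-identityʳ (map (false ∷_) s)) ⟩
      Σℤ (map (weight x) (map (false ∷_) s))
        ≡⟨ Σℤ-map-∘ (weight x) (false ∷_) s ⟩
      Σℤ (map (λ S → x * weight x S) s)
        ≡⟨ Σℤ-*ˡ x (weight x) s ⟩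
      x * Σℤ (map (weight x) s) ∎
      where open ≡-Reasoning
    Σ-weight-extend x true s = begin
      Σℤ (map (weight x) (map (false ∷_) s ++ map (true ∷_) s))
        ≡⟨ cong Σℤ (List.map-++ (weight x) (map (false ∷_) s) _) ⟩
      Σℤ (map (weight x) (map (false ∷_) s) ++ map (weight x) (map (true ∷_) s))
        ≡⟨ Σℤ-++ (map (weight x) (map (false ∷_) s)) _ ⟩
      Σℤ (map (weight x) (map (false ∷_) s)) + Σℤ (map (weight x) (map (true ∷_) s))
        ≡⟨ cong₂ _+_ (trans (Σℤ-map-∘ (weight x) (false ∷_) s) (Σℤ-*ˡ x (weight x) s))
                     (trans (Σℤ-map-∘ (weight x) (true ∷_) s) (Σℤ-*ˡ (+ 1 - x) (weight x) s)) ⟩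
      x * Σℤ (map (weight x) s) + (+ 1 - x) * Σℤ (map (weight x) s)
        ≡⟨ x+[1-x] x _ ⟩
      + 1 * Σℤ (map (weight x) s) ∎
      where
      open ≡-Reasoning
      x+[1-x] : ∀ (x s : ℤ) → x * s + (+ 1 - x) * s ≡ + 1 * s
      x+[1-x] = solve-∀

    Σ-weight-gluings : ∀ x L → Σℤ (map (weight x) (gluings L)) ≡ x ^ desList L
    Σ-weight-gluings x []          = refl
    Σ-weight-gluings x (_ ∷ [])    = refl
    Σ-weight-gluings x (p ∷ q ∷ r) = begin
      Σℤ (map (weight x) (gluings (p ∷ q ∷ r)))
        ≡⟨ Σ-weight-extend x (gluable p q) (gluings (q ∷ r)) ⟩
      (if gluable p q then + 1 else x) * Σℤ (map (weight x) (gluings (q ∷ r)))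
        ≡⟨ cong ((if gluable p q then + 1 else x) *_) (Σ-weight-gluings x (q ∷ r)) ⟩
      (if gluable p q then + 1 else x) * x ^ desList (q ∷ r)
        ≡⟨ ^-desList-∷∷ x p q r ⟨
      x ^ desList (p ∷ q ∷ r) ∎
      where open ≡-Reasoning

module ColouredWords where

  open import Defs using (ColPerm)
  open Lists using (Last; end; skip; Last-map⁺; Last-map⁻)
  open Gluings using (Letter)
  open import Data.Nat as ℕ using (ℕ; suc)
  open import Data.Nat.Properties using (suc-injective)
  open import Data.Fin as Fin using (Fin; toℕ)
  import Data.Fin.Properties as Fin
  open import Data.List using (List; []; _∷_; map; length)
  open import Data.Vec as Vec using (Vec; lookup; toList; zip; fromList; cast)
  import Data.Vec.Properties as Vec
  open import Data.Product using (_×_; proj₁; proj₂)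
  open import Data.Empty using (⊥-elim)
  open import Function using (_∘_)
  open import Relation.Nullary using (Dec)
  open import Relation.Nullary.Decidable using (recompute; _→-dec_)
  open import Relation.Binary.PropositionalEquality
  open import Data.List.Membership.Propositional using (_∉_)
  open import Data.Vec.Membership.Propositional.Properties using (∈-lookup; ∈-toList⁺; ∈-toList⁻)
  import Data.Vec.Relation.Unary.Any as AnyVec
  open import Data.Vec.Relation.Unary.Any.Properties using (lookup-index)
  open import Data.List.Relation.Unary.All using (_∷_)
  import Data.List.Relation.Unary.All as All
  import Data.List.Relation.Unary.All.Properties as All
  open import Data.List.Relation.Unary.Unique.Propositional using (Unique; []; _∷_)
  open import Data.List.Relation.Unary.Unique.DecPropositional using (unique?)

  private variable
    A B : Set
    m : ℕ

  Unique-toList⇒lookup-injective : (v : Vec A m) → Unique (toList v) →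
    ∀ i j → lookup v i ≡ lookup v j → i ≡ j
  Unique-toList⇒lookup-injective (x Vec.∷ v) u        Fin.zero    Fin.zero    e = refl
  Unique-toList⇒lookup-injective (x Vec.∷ v) (x∉ ∷ u) Fin.zero    (Fin.suc j) e =
    ⊥-elim (All.lookup x∉ (∈-toList⁺ (∈-lookup j v)) e)
  Unique-toList⇒lookup-injective (x Vec.∷ v) (x∉ ∷ u) (Fin.suc i) Fin.zero    e =
    ⊥-elim (All.lookup x∉ (∈-toList⁺ (∈-lookup i v)) (sym e))
  Unique-toList⇒lookup-injective (x Vec.∷ v) (_ ∷ u)  (Fin.suc i) (Fin.suc j) e =
    cong Fin.suc (Unique-toList⇒lookup-injective v u i j e)

  lookup-injective⇒Unique-toList : (v : Vec A m) → (∀ i j → lookup v i ≡ lookup v j → i ≡ j) →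
    Unique (toList v)
  lookup-injective⇒Unique-toList Vec.[]      _   = []
  lookup-injective⇒Unique-toList (x Vec.∷ v) inj =
    All.¬Any⇒All¬ (toList v) x∉v ∷
    lookup-injective⇒Unique-toList v (λ i j → Fin.suc-injective ∘ inj (Fin.suc i) (Fin.suc j))
    where
    x∉v : x ∉ toList v
    x∉v x∈v = let p = ∈-toList⁻ x∈v in Fin.0≢1+n (inj Fin.zero (Fin.suc (AnyVec.index p)) (lookup-index p))

  module _ (P : A → Set) where

    Last-toList⇒lookup-last : (v : Vec A (suc m)) → Last P (toList v) →
      ∀ i → suc (toℕ i) ≡ suc m → P (lookup v i)
    Last-toList⇒lookup-last         (x Vec.∷ Vec.[])    (end p)  Fin.zero    _ = p
    Last-toList⇒lookup-last {suc m} (x Vec.∷ y Vec.∷ v) (skip l) (Fin.suc i) e =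
      Last-toList⇒lookup-last (y Vec.∷ v) l i (suc-injective e)

    lookup-last⇒Last-toList : (v : Vec A (suc m)) → (∀ i → suc (toℕ i) ≡ suc m → P (lookup v i)) →
      Last P (toList v)
    lookup-last⇒Last-toList (x Vec.∷ Vec.[])    h = end (h Fin.zero refl)
    lookup-last⇒Last-toList (x Vec.∷ y Vec.∷ v) h =
      skip (lookup-last⇒Last-toList (y Vec.∷ v) (λ i e → h (Fin.suc i) (cong suc e)))

  map-proj₁-toList-zip : (v : Vec A m) (w : Vec B m) → map proj₁ (toList (zip v w)) ≡ toList v
  map-proj₁-toList-zip v w = trans (sym (Vec.toList-map proj₁ (zip v w))) (cong toList (Vec.map-proj₁-zip v w))

  map-proj₂-toList-zip : (v : Vec A m) (w : Vec B m) → map proj₂ (toList (zip v w)) ≡ toList w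
  map-proj₂-toList-zip v w = trans (sym (Vec.toList-map proj₂ (zip v w))) (cong toList (Vec.map-proj₂-zip v w))

  zip-map-proj : (v : Vec (A × B) m) → zip (Vec.map proj₁ v) (Vec.map proj₂ v) ≡ v
  zip-map-proj Vec.[]      = refl
  zip-map-proj (x Vec.∷ v) = cong (x Vec.∷_) (zip-map-proj v)

  module _ {n′ α : ℕ} {β : Fin α} where

    private
      n : ℕ
      n = suc n′

    letters : ColPerm n α β → List (Letter {n} {α})
    letters τ = toList (zip (ColPerm.word τ) (ColPerm.cols τ))

    length-letters : ∀ τ → length (letters τ) ≡ n
    length-letters τ = Vec.length-toList (zip (ColPerm.word τ) (ColPerm.cols τ))

    map-proj₁-letters : ∀ τ → map proj₁ (letters τ) ≡ toList (ColPerm.word τ)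
    map-proj₁-letters τ = map-proj₁-toList-zip (ColPerm.word τ) (ColPerm.cols τ)

    map-proj₂-letters : ∀ τ → map proj₂ (letters τ) ≡ toList (ColPerm.cols τ)
    map-proj₂-letters τ = map-proj₂-toList-zip (ColPerm.word τ) (ColPerm.cols τ)

    letters-unique : ∀ τ → Unique (map proj₁ (letters τ))
    letters-unique τ@record { word = w ; word-inj = inj } = recompute (unique? Fin._≟_ _)
      (subst Unique (sym (map-proj₁-letters τ)) (lookup-injective⇒Unique-toList w inj))

    letters-last : ∀ τ → Last ((_≡ β) ∘ proj₂) (letters τ)
    letters-last τ@record { cols = c ; last-β = last } = Last-map⁻ proj₂ (letters τ)
      (subst (Last (_≡ β)) (sym (map-proj₂-letters τ))
        (lookup-last⇒Last-toList (_≡ β) c (recompute last? last)))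
      where
      last? : Dec (∀ i → suc (toℕ i) ≡ n → lookup c i ≡ β)
      last? = Fin.all? λ i → (suc (toℕ i) ℕ.≟ n) →-dec (lookup c i Fin.≟ β)

    module _ (L : List (Letter {n} {α})) .(len : length L ≡ n) where

      private
        V : Vec (Letter {n} {α}) n
        V = cast len (fromList L)

        toList-V : toList V ≡ L
        toList-V = trans (Vec.toList-cast len (fromList L)) (Vec.toList∘fromList L)

      fromLetters : .(Unique (map proj₁ L)) → .(Last ((_≡ β) ∘ proj₂) L) → ColPerm n α β
      fromLetters u lb = record
        { word     = Vec.map proj₁ V
        ; cols     = Vec.map proj₂ V
        ; word-inj = Unique-toList⇒lookup-injective (Vec.map proj₁ V)
                       (subst Unique (sym (trans (Vec.toList-map proj₁ V) (cong (map proj₁) toList-V))) u)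
        ; last-β   = Last-toList⇒lookup-last (_≡ β) (Vec.map proj₂ V)
                       (subst (Last (_≡ β)) (sym (trans (Vec.toList-map proj₂ V) (cong (map proj₂) toList-V)))
                         (Last-map⁺ proj₂ L lb))
        }

      letters-fromLetters : ∀ .u .lb → letters (fromLetters u lb) ≡ L
      letters-fromLetters u lb = trans (cong toList (zip-map-proj V)) toList-V

    fromLetters-cong : ∀ {L L′} → L ≡ L′ → ∀ .{len len′ u u′ lb lb′} →
      fromLetters L len u lb ≡ fromLetters L′ len′ u′ lb′
    fromLetters-cong refl = refl

    fromLetters-letters : ∀ τ .{len u lb} → fromLetters (letters τ) len u lb ≡ τ
    fromLetters-letters record { word = w ; cols = c } {len} = colPerm-≡ word≡ cols≡
      where
      zip≡ : cast len (fromList (toList (zip w c))) ≡ zip w c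
      zip≡ = Vec.fromList∘toList (zip w c)
      word≡ : Vec.map proj₁ (cast len (fromList (toList (zip w c)))) ≡ w
      word≡ = trans (cong (Vec.map proj₁) zip≡) (Vec.map-proj₁-zip w c)
      cols≡ : Vec.map proj₂ (cast len (fromList (toList (zip w c)))) ≡ c
      cols≡ = trans (cong (Vec.map proj₂) zip≡) (Vec.map-proj₂-zip w c)
      colPerm-≡ : ∀ {w w′ c c′} .{p q p′ q′} → w ≡ w′ → c ≡ c′ →
        _≡_ {A = ColPerm n α β} record { word = w ; cols = c ; word-inj = p ; last-β = q }
                                record { word = w′ ; cols = c′ ; word-inj = p′ ; last-β = q′ }
      colPerm-≡ refl refl = refl

module Counting (n′ α : ℕ) (β : Fin α) where

  open import Defs using (Face; ColPerm; Σℤ; eulerianPoly; des)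
  open IntegerSums
  open Gluings
  open Lists using (∈-enumeration)
  open ColouredWords using (letters; length-letters)
  open import Data.Nat as ℕ using (ℕ; suc; _∸_; _<_; _≤_)
  open import Data.Integer using (ℤ; +_; _*_; _-_; _^_)
  import Data.Integer.Properties as ℤ
  open import Data.List as List using (List; map; allFin; upTo; length)
  import Data.List.Properties as List
  open import Data.Fin using (Fin)
  open import Data.Bool using (Bool)
  open import Data.Product using (Σ; _×_; _,_; proj₁; proj₂)
  open import Function using (_∘_)
  open import Function.Bundles using (_↔_; Inverse; Injection; mk⇔)
  open import Function.Properties.Inverse using (↔⇒↣)
  open import Relation.Binary.PropositionalEquality
  open import Data.List.Membership.Propositional using (_∈_)
  open import Data.List.Membership.Propositional.Properties using (∈-map⁺; ∈-map⁻; ∈-upTo⁺)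
  open import Data.List.Relation.Unary.Unique.Propositional using (Unique)
  import Data.List.Relation.Unary.Unique.Propositional.Properties as Unique
  open import Data.List.Relation.Binary.Permutation.Propositional using (_↭_)
  open import Data.List.Relation.Binary.BagAndSetEquality using (∼bag⇒↭)
  open import Data.List.Membership.Propositional.Properties.WithK using (unique∧set⇒bag)

  private
    n : ℕ
    n = suc n′

  IsGluingOf : ColPerm n α β × List Bool → Set
  IsGluingOf (τ , S) = Gluing (letters τ) S

  IsGluingOf⇒length : ∀ {τ S} → IsGluingOf (τ , S) → length S ≡ n′
  IsGluingOf⇒length {τ} g = trans (Gluing-length g) (cong (_∸ 1) (length-letters τ))

  record FaceGluingBijection : Set where
    field
      toGluing       : Σ ℕ (Face n α β) → ColPerm n α β × List Bool
      toGluing-valid : ∀ F → IsGluingOf (toGluing F)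
      toGluing-dim   : ∀ F → trues (proj₂ (toGluing F)) ≡ proj₁ F
      fromGluing     : (t : ColPerm n α β × List Bool) → .(IsGluingOf t) → Σ ℕ (Face n α β)
      from∘to        : ∀ F → fromGluing (toGluing F) (toGluing-valid F) ≡ F
      to∘from        : ∀ t (g : IsGluingOf t) → toGluing (fromGluing t g) ≡ t

    toGluing-injective : ∀ {F F′} → toGluing F ≡ toGluing F′ → F ≡ F′
    toGluing-injective {F} {F′} eq = begin
      F                                            ≡⟨ from∘to F ⟨
      fromGluing (toGluing F) (toGluing-valid F)   ≡⟨ fromGluing-cong eq ⟩
      fromGluing (toGluing F′) (toGluing-valid F′) ≡⟨ from∘to F′ ⟩
      F′                                           ∎
      where
      open ≡-Reasoning
      fromGluing-cong : ∀ {t t′} → t ≡ t′ → .{g : IsGluingOf t} .{g′ : IsGluingOf t′} →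
        fromGluing t g ≡ fromGluing t′ g′
      fromGluing-cong refl = refl

  faceTerm : ℤ → ℕ → ℤ
  faceTerm x d = x ^ (n ∸ 1 ∸ d) * (+ 1 - x) ^ d

  module Enumerated (bij : FaceGluingBijection)
    (f : ℕ → ℕ) (faces : (d : ℕ) → Fin (f d) ↔ Face n α β d)
    (N : ℕ) (perms : Fin N ↔ ColPerm n α β) where

    open FaceGluingBijection bij

    facesOfDim : (d : ℕ) → List (Face n α β d)
    facesOfDim d = map (Inverse.to (faces d)) (allFin (f d))

    allFaces : List (Σ ℕ (Face n α β))
    allFaces = Σ-list (upTo n) facesOfDim

    allPerms : List (ColPerm n α β)
    allPerms = map (Inverse.to perms) (allFin N)

    allGluings : List (ColPerm n α β × List Bool)
    allGluings = Σ-list allPerms (gluings ∘ letters)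

    eulerianPoly≡Σ-faces : ∀ x → eulerianPoly n f x ≡ Σℤ (map (faceTerm x ∘ proj₁) allFaces)
    eulerianPoly≡Σ-faces x = begin
      eulerianPoly n f x
        ≡⟨ cong Σℤ (List.map-cong f-copies (upTo n)) ⟩
      Σℤ (map (λ d → Σℤ (map (λ _ → faceTerm x d) (facesOfDim d))) (upTo n))
        ≡⟨ Σℤ-Σ-list (faceTerm x ∘ proj₁) (upTo n) facesOfDim ⟨
      Σℤ (map (faceTerm x ∘ proj₁) allFaces) ∎
      where
      open ≡-Reasoning
      f-copies : ∀ d → + f d * x ^ (n ∸ 1 ∸ d) * (+ 1 - x) ^ d ≡
                       Σℤ (map (λ _ → faceTerm x d) (facesOfDim d))
      f-copies d = begin
        + f d * x ^ (n ∸ 1 ∸ d) * (+ 1 - x) ^ d       ≡⟨ ℤ.*-assoc (+ f d) _ _ ⟩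
        + f d * faceTerm x d                          ≡⟨ cong (λ m → + m * faceTerm x d) #facesOfDim ⟨
        + length (facesOfDim d) * faceTerm x d        ≡⟨ Σℤ-const (faceTerm x d) (facesOfDim d) ⟨
        Σℤ (map (λ _ → faceTerm x d) (facesOfDim d))  ∎
        where
        #facesOfDim : length (facesOfDim d) ≡ f d
        #facesOfDim = trans (List.length-map (Inverse.to (faces d)) (allFin (f d)))
                            (List.length-tabulate {n = f d} (λ i → i))

    faceTerm≡weight : ∀ x F → faceTerm x (proj₁ F) ≡ weight x (proj₂ (toGluing F))
    faceTerm≡weight x F = sym (trans (weight-closed x (proj₂ (toGluing F)))
      (cong₂ (λ l t → x ^ (l ∸ t) * (+ 1 - x) ^ t)
             (IsGluingOf⇒length {proj₁ (toGluing F)} (toGluing-valid F)) (toGluing-dim F)))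

    map-toGluing-↭ : map toGluing allFaces ↭ allGluings
    map-toGluing-↭ = ∼bag⇒↭ (unique∧set⇒bag unique-faces unique-gluings (mk⇔ image⊆ ⊆image))
      where
      unique-faces : Unique (map toGluing allFaces)
      unique-faces = Unique.map⁺ toGluing-injective
        (Σ-list-unique (upTo n) facesOfDim (Unique.upTo⁺ n)
          (λ d → Unique.map⁺ (Injection.injective (↔⇒↣ (faces d))) (Unique.allFin⁺ (f d))))

      unique-gluings : Unique allGluings
      unique-gluings = Σ-list-unique allPerms (gluings ∘ letters)
        (Unique.map⁺ (Injection.injective (↔⇒↣ perms)) (Unique.allFin⁺ N)) (gluings-unique ∘ letters)

      image⊆ : ∀ {t} → t ∈ map toGluing allFaces → t ∈ allGluings
      image⊆ t∈ with ∈-map⁻ toGluing t∈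
      ... | F , _ , refl = ∈-Σ-list⁺ (∈-enumeration perms _) (Gluing⇒∈gluings (toGluing-valid F))

      ⊆image : ∀ {t} → t ∈ allGluings → t ∈ map toGluing allFaces
      ⊆image {τ , S} t∈ = subst (_∈ _) (to∘from (τ , S) g) (∈-map⁺ toGluing (∈-Σ-list⁺ d∈ F∈))
        where
        g : Gluing (letters τ) S
        g = ∈gluings⇒Gluing (letters τ) (proj₂ (∈-Σ-list⁻ allPerms (gluings ∘ letters) t∈))
        F : Σ ℕ (Face n α β)
        F = fromGluing (τ , S) g
        d≡ : trues S ≡ proj₁ F
        d≡ = trans (cong (trues ∘ proj₂) (sym (to∘from (τ , S) g))) (toGluing-dim F)
        d∈ : proj₁ F ∈ upTo n
        d∈ = ∈-upTo⁺ (subst (_< n) d≡ (ℕ.s≤s (subst (trues S ≤_) (IsGluingOf⇒length {τ} g)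
                                                     (trues≤length S))))
        F∈ : proj₂ F ∈ facesOfDim (proj₁ F)
        F∈ = ∈-enumeration (faces (proj₁ F)) (proj₂ F)

    Σ-gluings≡Σ-des : ∀ x →
      Σℤ (map (weight x ∘ proj₂) allGluings) ≡ Σℤ (map (λ i → x ^ des (Inverse.to perms i)) (allFin N))
    Σ-gluings≡Σ-des x = begin
      Σℤ (map (weight x ∘ proj₂) allGluings)
        ≡⟨ Σℤ-Σ-list (weight x ∘ proj₂) allPerms (gluings ∘ letters) ⟩
      Σℤ (map (λ τ → Σℤ (map (weight x) (gluings (letters τ)))) allPerms)
        ≡⟨ cong Σℤ (List.map-cong (Σ-weight-gluings x ∘ letters) allPerms) ⟩
      Σℤ (map (λ τ → x ^ des τ) allPerms)
        ≡⟨ Σℤ-map-∘ (λ τ → x ^ des τ) (Inverse.to perms) (allFin N) ⟩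
      Σℤ (map (λ i → x ^ des (Inverse.to perms i)) (allFin N)) ∎
      where open ≡-Reasoning

module Pieces where

  open import Defs using (Σℕ)
  open Lists
  open Gluings
  open import Data.Nat as ℕ using (ℕ; suc; _∸_; _+_)
  import Data.Nat.Properties as ℕ
  open import Data.List as List using (List; []; _∷_; _++_; map; length; concat)
  import Data.List.Properties as List
  open import Data.Fin as Fin using (Fin)
  open import Data.Bool using (Bool; true; false)
  open import Data.Product using (∃₂; _×_; _,_; proj₁; proj₂)
  open import Function using (_∘_)
  open import Relation.Binary.PropositionalEquality
  open import Data.List.Relation.Unary.All as All using (All; []; _∷_)
  open import Data.List.Relation.Unary.AllPairs using ([]; _∷_)
  open import Data.List.Relation.Unary.Unique.Propositional using (Unique)

  glueRun : {A : Set} → List A → List Bool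
  glueRun []           = []
  glueRun (_ ∷ [])     = []
  glueRun (_ ∷ y ∷ ys) = true ∷ glueRun (y ∷ ys)

  trues-glueRun : {A : Set} (xs : List A) → trues (glueRun xs) ≡ length xs ∸ 1
  trues-glueRun []           = refl
  trues-glueRun (_ ∷ [])     = refl
  trues-glueRun (_ ∷ y ∷ ys) = cong suc (trues-glueRun (y ∷ ys))

  module _ {n α : ℕ} where

    Piece : Set
    Piece = Fin α × List (Fin n)

    NonEmptyPieces : List Piece → Set
    NonEmptyPieces = All (NonEmpty ∘ proj₂)

    IncreasingPieces : List Piece → Set
    IncreasingPieces = All (Increasing ∘ proj₂)

    elements : List Piece → List (Fin n)
    elements P = concat (map proj₂ P)

    dimension : List Piece → ℕ
    dimension P = Σℕ (map (λ pc → length (proj₂ pc) ∸ 1) P)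

    lettersOf : List Piece → List (Letter {n} {α})
    lettersOf []             = []
    lettersOf ((c , sb) ∷ P) = map (_, c) sb ++ lettersOf P

    gluingOf : List Piece → List Bool
    gluingOf []                     = []
    gluingOf ((c , sb) ∷ [])        = glueRun sb
    gluingOf ((c , sb) ∷ P@(_ ∷ _)) = glueRun sb ++ false ∷ gluingOf P

    -- A glued letter joins the following piece and imposes its own colour on it; on a gluing
    -- nothing is lost, since glued letters have equal colours (gluable⇒≡colour).
    push : Letter {n} {α} → Bool → List Piece → List Piece
    push (e , c) false P              = (c , e ∷ []) ∷ P
    push (e , c) true  []             = (c , e ∷ []) ∷ []
    push (e , c) true  ((_ , sb) ∷ P) = (c , e ∷ sb) ∷ P

    cutAt : List (Letter {n} {α}) → List Bool → List Piece
    cutAt []             _        = []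
    cutAt ((e , c) ∷ []) _        = (c , e ∷ []) ∷ []
    cutAt (p ∷ q ∷ r)    []       = push p false (cutAt (q ∷ r) [])
    cutAt (p ∷ q ∷ r)    (b ∷ bs) = push p b (cutAt (q ∷ r) bs)

    cutAt-lettersOf : ∀ P → NonEmptyPieces P → cutAt (lettersOf P) (gluingOf P) ≡ P
    cutAt-lettersOf []                  _        = refl
    cutAt-lettersOf ((c , e ∷ sb) ∷ P) (_ ∷ ne) = run e sb P (cutAt-lettersOf P ne) ne
      where
      run : ∀ e sb P → cutAt (lettersOf P) (gluingOf P) ≡ P → NonEmptyPieces P →
        cutAt (lettersOf ((c , e ∷ sb) ∷ P)) (gluingOf ((c , e ∷ sb) ∷ P)) ≡ (c , e ∷ sb) ∷ P
      run e []        []                ih _        = refl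
      run e []        ((_ , _ ∷ _) ∷ _) ih _        = cong ((c , e ∷ []) ∷_) ih
      run e []        ((_ , []) ∷ _)    ih (() ∷ _)
      run e (e′ ∷ sb) []                ih ne rewrite run e′ sb [] ih ne = refl
      run e (e′ ∷ sb) P@(_ ∷ _)         ih ne rewrite run e′ sb P ih ne  = refl

    cutAt-head : ∀ q r bs → ∃₂ λ sb P → cutAt (q ∷ r) bs ≡ (proj₂ q , proj₁ q ∷ sb) ∷ P
    cutAt-head q []       bs           = [] , [] , refl
    cutAt-head q (q′ ∷ r) []           = [] , _ , refl
    cutAt-head q (q′ ∷ r) (false ∷ bs) = [] , _ , refl
    cutAt-head q (q′ ∷ r) (true ∷ bs) with cutAt-head q′ r bs
    ... | sb , P , eq rewrite eq = proj₁ q′ ∷ sb , P , refl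

    cutAt-inverse : ∀ {L S} → Gluing L S → lettersOf (cutAt L S) ≡ L × gluingOf (cutAt L S) ≡ S
    cutAt-inverse []  = refl , refl
    cutAt-inverse [-] = refl , refl
    cutAt-inverse {p ∷ q ∷ r} {false ∷ bs} (cut g) with cutAt-head q r bs | cutAt-inverse g
    ... | sb , P , eq | ih₁ , ih₂ rewrite eq = cong (p ∷_) ih₁ , cong (false ∷_) ih₂
    cutAt-inverse {(e , c) ∷ q ∷ r} {true ∷ bs} (glue pq g)
      with cutAt-head q r bs | cutAt-inverse g | gluable⇒≡colour (e , c) q pq
    ... | sb , P , eq | ih₁ , ih₂ | refl rewrite eq = cong ((e , c) ∷_) ih₁ , extend P ih₂
      where
      extend : ∀ P → gluingOf ((c , proj₁ q ∷ sb) ∷ P) ≡ bs →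
        gluingOf ((c , e ∷ proj₁ q ∷ sb) ∷ P) ≡ true ∷ bs
      extend []      h = cong (true ∷_) h
      extend (_ ∷ _) h = cong (true ∷_) h

    push-nonEmpty : ∀ p b {P} → NonEmptyPieces P → NonEmptyPieces (push p b P)
    push-nonEmpty (e , c) false         ne       = _ ∷ ne
    push-nonEmpty (e , c) true  {[]}    _        = _ ∷ []
    push-nonEmpty (e , c) true  {_ ∷ _} (_ ∷ ne) = _ ∷ ne

    cutAt-nonEmpty : ∀ L S → NonEmptyPieces (cutAt L S)
    cutAt-nonEmpty []          S        = []
    cutAt-nonEmpty (p ∷ [])    S        = _ ∷ []
    cutAt-nonEmpty (p ∷ q ∷ r) []       = push-nonEmpty p false (cutAt-nonEmpty (q ∷ r) [])
    cutAt-nonEmpty (p ∷ q ∷ r) (b ∷ bs) = push-nonEmpty p b (cutAt-nonEmpty (q ∷ r) bs)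

    cutAt-increasing : ∀ {L S} → Gluing L S → Unique (map proj₁ L) → IncreasingPieces (cutAt L S)
    cutAt-increasing []          _       = []
    cutAt-increasing [-]         _       = ([] ∷ []) ∷ []
    cutAt-increasing (cut g)     (_ ∷ u) = ([] ∷ []) ∷ cutAt-increasing g u
    cutAt-increasing {p ∷ q ∷ r} {true ∷ bs} (glue pq g) (p∉ ∷ u)
      with cutAt-head q r bs | cutAt-increasing g u
    ... | sb , P , eq | ih rewrite eq with ih
    ... | (q< ∷ sb↗) ∷ P↗ = ((p<q ∷ All.map (ℕ.<-trans p<q) q<) ∷ q< ∷ sb↗) ∷ P↗
      where
      p<q : proj₁ p Fin.< proj₁ q
      p<q = gluable∧≢⇒< p q pq (All.head p∉)

    map-proj₁-lettersOf : ∀ P → map proj₁ (lettersOf P) ≡ elements P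
    map-proj₁-lettersOf []             = refl
    map-proj₁-lettersOf ((c , sb) ∷ P) = begin
      map proj₁ (map (_, c) sb ++ lettersOf P)
        ≡⟨ List.map-++ proj₁ (map (_, c) sb) (lettersOf P) ⟩
      map proj₁ (map (_, c) sb) ++ map proj₁ (lettersOf P)
        ≡⟨ cong₂ _++_ (trans (sym (List.map-∘ sb)) (List.map-id sb)) (map-proj₁-lettersOf P) ⟩
      sb ++ elements P ∎
      where open ≡-Reasoning

    lettersOf-nonEmpty : ∀ pc P → NonEmptyPieces (pc ∷ P) → NonEmpty (lettersOf (pc ∷ P))
    lettersOf-nonEmpty (c , _ ∷ _) P _        = _
    lettersOf-nonEmpty (c , [])    P (() ∷ _)

    module _ (Q : Fin α → Set) where

      Last-lettersOf⁻ : ∀ P → NonEmptyPieces P → Last (Q ∘ proj₂) (lettersOf P) → Last (Q ∘ proj₁) P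
      Last-lettersOf⁻ ((c , sb) ∷ [])     _        l =
        end (Last-const⁻ (Last-map⁻ (_, c) sb (subst (Last _) (List.++-identityʳ _) l)))
      Last-lettersOf⁻ ((c , sb) ∷ pc ∷ P) (_ ∷ ne) l =
        skip (Last-lettersOf⁻ (pc ∷ P) ne (Last-++⁻ʳ (map (_, c) sb) (lettersOf-nonEmpty pc P ne) l))

      Last-lettersOf⁺ : ∀ P → NonEmptyPieces P → Last (Q ∘ proj₁) P → Last (Q ∘ proj₂) (lettersOf P)
      Last-lettersOf⁺ ((c , sb) ∷ [])     (ne ∷ _) (end q)  =
        subst (Last _) (sym (List.++-identityʳ _)) (Last-map⁺ (_, c) sb (Last-const⁺ sb ne q))
      Last-lettersOf⁺ ((c , sb) ∷ pc ∷ P) (_ ∷ ne) (skip l) =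
        Last-++⁺ʳ (map (_, c) sb) (Last-lettersOf⁺ (pc ∷ P) ne l)

    lettersOf-Gluing : ∀ P → NonEmptyPieces P → IncreasingPieces P → Gluing (lettersOf P) (gluingOf P)
    lettersOf-Gluing []                 _        _          = []
    lettersOf-Gluing ((c , e ∷ sb) ∷ P) (_ ∷ ne) (sb↗ ∷ P↗) = run e sb P (lettersOf-Gluing P ne P↗) ne sb↗
      where
      run : ∀ e sb P → Gluing (lettersOf P) (gluingOf P) → NonEmptyPieces P → Increasing (e ∷ sb) →
        Gluing (lettersOf ((c , e ∷ sb) ∷ P)) (gluingOf ((c , e ∷ sb) ∷ P))
      run e []        []                ih _        _                 = [-]
      run e []        ((_ , _ ∷ _) ∷ _) ih _        _                 = cut ih
      run e []        ((_ , []) ∷ _)    ih (() ∷ _) _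
      run e (e′ ∷ sb) []                ih ne       ((e<e′ ∷ _) ∷ s↗) =
        glue (<⇒gluable c e<e′) (run e′ sb [] ih ne s↗)
      run e (e′ ∷ sb) P@(_ ∷ _)         ih ne       ((e<e′ ∷ _) ∷ s↗) =
        glue (<⇒gluable c e<e′) (run e′ sb P ih ne s↗)

    trues-gluingOf : ∀ P → trues (gluingOf P) ≡ dimension P
    trues-gluingOf []                     = refl
    trues-gluingOf ((c , sb) ∷ [])        = trans (trues-glueRun sb) (sym (ℕ.+-identityʳ _))
    trues-gluingOf ((c , sb) ∷ P@(_ ∷ _)) =
      trans (trues-++ (glueRun sb) (false ∷ gluingOf P)) (cong₂ _+_ (trues-glueRun sb) (trues-gluingOf P))

module Blocks where

  open import Defs using (Σℕ)
  open Lists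
  open Pieces
  open import Data.Nat as ℕ using (ℕ; _∸_; _+_)
  import Data.Nat.Properties as ℕ
  import Data.Nat.ListAction.Properties as ℕ
  open import Data.List as List using (List; []; _∷_; _++_; map; length; concat; null)
  import Data.List.Properties as List
  open import Data.Fin as Fin using (Fin)
  import Data.Fin.Properties as Fin
  open import Data.Bool using (if_then_else_)
  open import Data.Product using (_×_; _,_; proj₁; proj₂)
  open import Data.Unit using (⊤)
  open import Data.Empty using (⊥-elim)
  open import Function using (_∘_)
  open import Relation.Nullary using (yes; no)
  open import Relation.Binary.PropositionalEquality
  open import Data.List.Relation.Unary.All as All using (All; []; _∷_)
  import Data.List.Relation.Unary.All.Properties as All
  open import Data.List.Relation.Unary.Linked using (Linked; []; [-]; _∷_)

  module _ {n α : ℕ} where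

    Block : Set
    Block = Fin α × List (List (Fin n))

    NonEmptyBlocks : List Block → Set
    NonEmptyBlocks = All (NonEmpty ∘ proj₂)

    Alternating : List Block → Set
    Alternating = Linked (λ b b′ → proj₁ b ≢ proj₁ b′)

    blockElements : List Block → List (Fin n)
    blockElements B = concat (map (concat ∘ proj₂) B)

    blockDimension : List Block → ℕ
    blockDimension B = Σℕ (map (λ b → length (concat (proj₂ b)) ∸ length (proj₂ b)) B)

    ungroup : List Block → List (Piece {n} {α})
    ungroup []               = []
    ungroup ((c , sbs) ∷ B) = map (c ,_) sbs ++ ungroup B

    pushPiece : Fin α → List (Fin n) → List Block → List Block
    pushPiece c sb []                = (c , sb ∷ []) ∷ []
    pushPiece c sb ((c′ , sbs) ∷ B) with c Fin.≟ c′
    ... | yes _ = (c , sb ∷ sbs) ∷ B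
    ... | no _  = (c , sb ∷ []) ∷ (c′ , sbs) ∷ B

    group : List (Piece {n} {α}) → List Block
    group []             = []
    group ((c , sb) ∷ P) = pushPiece c sb (group P)

    ungroup-pushPiece : ∀ c sb B → ungroup (pushPiece c sb B) ≡ (c , sb) ∷ ungroup B
    ungroup-pushPiece c sb []                = refl
    ungroup-pushPiece c sb ((c′ , sbs) ∷ B) with c Fin.≟ c′
    ... | yes refl = refl
    ... | no _     = refl

    ungroup-group : ∀ P → ungroup (group P) ≡ P
    ungroup-group []             = refl
    ungroup-group ((c , sb) ∷ P) = trans (ungroup-pushPiece c sb (group P)) (cong ((c , sb) ∷_) (ungroup-group P))

    _≢head_ : Fin α → List Block → Set
    c ≢head []            = ⊤
    c ≢head ((c′ , _) ∷ _) = c ≢ c′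

    pushPiece-≢ : ∀ c sb B → c ≢head B → pushPiece c sb B ≡ (c , sb ∷ []) ∷ B
    pushPiece-≢ c sb []                _   = refl
    pushPiece-≢ c sb ((c′ , sbs) ∷ B) c≢ with c Fin.≟ c′
    ... | yes c≡c′ = ⊥-elim (c≢ c≡c′)
    ... | no _     = refl

    pushPiece-≡ : ∀ c sb sbs B → pushPiece c sb ((c , sbs) ∷ B) ≡ (c , sb ∷ sbs) ∷ B
    pushPiece-≡ c sb sbs B with c Fin.≟ c
    ... | yes _   = refl
    ... | no c≢c  = ⊥-elim (c≢c refl)

    Alternating⇒≢head : ∀ {c sbs B} → Alternating ((c , sbs) ∷ B) → c ≢head B
    Alternating⇒≢head {B = []}    _       = _
    Alternating⇒≢head {B = _ ∷ _} (c≢ ∷ _) = c≢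

    Alternating-tail : ∀ {b B} → Alternating (b ∷ B) → Alternating B
    Alternating-tail [-]     = []
    Alternating-tail (_ ∷ a) = a

    group-ungroup : ∀ B → Alternating B → NonEmptyBlocks B → group (ungroup B) ≡ B
    group-ungroup []                     _ _         = refl
    group-ungroup ((c , sb ∷ sbs) ∷ B) a (_ ∷ ne) =
      trans (cong (pushPiece c sb) (regroup sbs)) (close sbs)
      where
      ih : group (ungroup B) ≡ B
      ih = group-ungroup B (Alternating-tail a) ne
      regroup : ∀ sbs → group (map (c ,_) sbs ++ ungroup B) ≡ (if null sbs then B else (c , sbs) ∷ B)
      regroup []              = ih
      regroup (s ∷ [])        = trans (cong (pushPiece c s) ih) (pushPiece-≢ c s B (Alternating⇒≢head a))
      regroup (s ∷ s′ ∷ sbs) =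
        trans (cong (pushPiece c s) (regroup (s′ ∷ sbs))) (pushPiece-≡ c s (s′ ∷ sbs) B)
      close : ∀ sbs → pushPiece c sb (if null sbs then B else (c , sbs) ∷ B) ≡ (c , sb ∷ sbs) ∷ B
      close []      = pushPiece-≢ c sb B (Alternating⇒≢head a)
      close (_ ∷ _) = pushPiece-≡ c sb _ B

    pushPiece-alternating : ∀ c sb B → Alternating B → Alternating (pushPiece c sb B)
    pushPiece-alternating c sb []                a = [-]
    pushPiece-alternating c sb ((c′ , sbs) ∷ B) a with c Fin.≟ c′
    pushPiece-alternating c sb ((c , sbs) ∷ B)  [-]      | yes refl = [-]
    pushPiece-alternating c sb ((c , sbs) ∷ B)  (c≢ ∷ a) | yes refl = c≢ ∷ a
    ... | no c≢c′ = c≢c′ ∷ a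

    group-alternating : ∀ P → Alternating (group P)
    group-alternating []             = []
    group-alternating ((c , sb) ∷ P) = pushPiece-alternating c sb (group P) (group-alternating P)

    pushPiece-nonEmpty : ∀ c sb B → NonEmptyBlocks B → NonEmptyBlocks (pushPiece c sb B)
    pushPiece-nonEmpty c sb []                _        = _ ∷ []
    pushPiece-nonEmpty c sb ((c′ , sbs) ∷ B) (b ∷ bs) with c Fin.≟ c′
    ... | yes _ = _ ∷ bs
    ... | no _  = _ ∷ b ∷ bs

    group-nonEmpty : ∀ P → NonEmptyBlocks (group P)
    group-nonEmpty []             = []
    group-nonEmpty ((c , sb) ∷ P) = pushPiece-nonEmpty c sb (group P) (group-nonEmpty P)

    module _ {R : Piece {n} {α} → Set} where

      All-ungroup⁻ : ∀ B → All R (ungroup B) → All (λ b → All (λ sb → R (proj₁ b , sb)) (proj₂ b)) B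
      All-ungroup⁻ []               _ = []
      All-ungroup⁻ ((c , sbs) ∷ B) r =
        All.map⁻ (All.++⁻ˡ (map (c ,_) sbs) r) ∷ All-ungroup⁻ B (All.++⁻ʳ (map (c ,_) sbs) r)

      All-ungroup⁺ : ∀ B → All (λ b → All (λ sb → R (proj₁ b , sb)) (proj₂ b)) B → All R (ungroup B)
      All-ungroup⁺ []               _        = []
      All-ungroup⁺ ((c , sbs) ∷ B) (r ∷ rs) = All.++⁺ (All.map⁺ r) (All-ungroup⁺ B rs)

    elements-ungroup : ∀ B → elements (ungroup B) ≡ blockElements B
    elements-ungroup []               = refl
    elements-ungroup ((c , sbs) ∷ B) = begin
      concat (map proj₂ (map (c ,_) sbs ++ ungroup B))
        ≡⟨ cong concat (List.map-++ proj₂ (map (c ,_) sbs) (ungroup B)) ⟩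
      concat (map proj₂ (map (c ,_) sbs) ++ map proj₂ (ungroup B))
        ≡⟨ List.concat-++ (map proj₂ (map (c ,_) sbs)) (map proj₂ (ungroup B)) ⟨
      concat (map proj₂ (map (c ,_) sbs)) ++ elements (ungroup B)
        ≡⟨ cong₂ _++_ (cong concat (trans (sym (List.map-∘ sbs)) (List.map-id sbs))) (elements-ungroup B) ⟩
      concat sbs ++ blockElements B ∎
      where open ≡-Reasoning

    blockElements-group : ∀ P → blockElements (group P) ≡ elements P
    blockElements-group P = trans (sym (elements-ungroup (group P))) (cong elements (ungroup-group P))

    module _ (Q : Fin α → Set) where

      Last-ungroup⁻ : ∀ B → NonEmptyBlocks B → Last (Q ∘ proj₁) (ungroup B) → Last (Q ∘ proj₁) B
      Last-ungroup⁻ ((c , sbs) ∷ []) (ne ∷ _) l =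
        end (Last-const⁻ (Last-map⁻ (c ,_) sbs (subst (Last _) (List.++-identityʳ _) l)))
      Last-ungroup⁻ ((c , sbs) ∷ (c′ , s ∷ sbs′) ∷ B) (_ ∷ ne) l =
        skip (Last-ungroup⁻ ((c′ , s ∷ sbs′) ∷ B) ne (Last-++⁻ʳ (map (c ,_) sbs) _ l))
      Last-ungroup⁻ ((c , sbs) ∷ (c′ , []) ∷ B) (_ ∷ () ∷ _) l

      Last-ungroup⁺ : ∀ B → NonEmptyBlocks B → Last (Q ∘ proj₁) B → Last (Q ∘ proj₁) (ungroup B)
      Last-ungroup⁺ ((c , sbs) ∷ []) (ne ∷ _) (end q) =
        subst (Last _) (sym (List.++-identityʳ _)) (Last-map⁺ (c ,_) sbs (Last-const⁺ sbs ne q))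
      Last-ungroup⁺ ((c , sbs) ∷ (c′ , s ∷ sbs′) ∷ B) (_ ∷ ne) (skip l) =
        Last-++⁺ʳ (map (c ,_) sbs) (Last-ungroup⁺ ((c′ , s ∷ sbs′) ∷ B) ne l)
      Last-ungroup⁺ ((c , sbs) ∷ (c′ , []) ∷ B) (_ ∷ () ∷ _) l

    dimension-ungroup : ∀ B → All (All NonEmpty ∘ proj₂) B → dimension (ungroup B) ≡ blockDimension B
    dimension-ungroup []               _        = refl
    dimension-ungroup ((c , sbs) ∷ B) (ne ∷ nes) = begin
      Σℕ (map d (map (c ,_) sbs ++ ungroup B))
        ≡⟨ cong Σℕ (List.map-++ d (map (c ,_) sbs) (ungroup B)) ⟩
      Σℕ (map d (map (c ,_) sbs) ++ map d (ungroup B))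
        ≡⟨ ℕ.sum-++ (map d (map (c ,_) sbs)) _ ⟩
      Σℕ (map d (map (c ,_) sbs)) + dimension (ungroup B)
        ≡⟨ cong₂ _+_ (trans (cong Σℕ (sym (List.map-∘ sbs))) (dimension-block sbs ne))
                     (dimension-ungroup B nes) ⟩
      (length (concat sbs) ∸ length sbs) + blockDimension B ∎
      where
      open ≡-Reasoning
      d : Piece {n} {α} → ℕ
      d pc = length (proj₂ pc) ∸ 1
      dimension-block : ∀ sbs → All NonEmpty sbs →
        Σℕ (map (λ sb → length sb ∸ 1) sbs) ≡ length (concat sbs) ∸ length sbs
      dimension-block []                _        = refl
      dimension-block ((e ∷ sb) ∷ sbs) (_ ∷ ne) = begin
        length sb + Σℕ (map (λ sb → length sb ∸ 1) sbs)  ≡⟨ cong (length sb +_) (dimension-block sbs ne) ⟩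
        length sb + (length (concat sbs) ∸ length sbs)   ≡⟨ ℕ.+-∸-assoc (length sb) (length≤length-concat sbs ne) ⟨
        (length sb + length (concat sbs)) ∸ length sbs   ≡⟨ cong (_∸ length sbs) (List.length-++ sb) ⟨
        length (sb ++ concat sbs) ∸ length sbs           ∎

module FaceCodes (n′ α : ℕ) (β : Fin α) where

  open import Defs using (Face; Σℕ; blockSize; subBlocks; faceDim)
  open Lists
  open Blocks
  open import Data.Nat as ℕ using (zero; suc; _<_; _≤_; _∸_)
  import Data.Nat.Properties as ℕ
  open import Data.List as List using (List; []; _∷_; map; length; concat; allFin; filter; applyUpTo)
  import Data.List.Properties as List
  open import Data.Vec as Vec using (Vec; lookup; tabulate)
  import Data.Vec.Properties as Vec
  open import Data.Maybe as Maybe using (just)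
  open import Data.Fin as Fin using (toℕ)
  import Data.Fin.Properties as Fin
  open import Data.Bool using (Bool)
  open import Data.Product using (Σ; ∃; ∃₂; _×_; _,_; proj₁; proj₂)
  open import Data.Sum using (inj₁; inj₂)
  open import Data.Empty using (⊥; ⊥-elim)
  import Data.Empty.Irrelevant as Irrelevant
  open import Function using (_∘_)
  open import Function.Bundles using (mk⇔)
  open import Relation.Nullary using (Dec; does)
  open import Relation.Nullary.Decidable using (⌊_⌋; _×-dec_; _→-dec_; ¬?; recompute; dec-true; dec-false)
  open import Relation.Binary.PropositionalEquality
  open import Data.List.Relation.Unary.All using (All; []; _∷_)
  import Data.List.Relation.Unary.All as All
  import Data.List.Relation.Unary.All.Properties as All
  import Data.List.Relation.Unary.Any as Any
  open import Data.List.Relation.Unary.Unique.Propositional using (Unique)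
  import Data.List.Relation.Unary.AllPairs.Properties as AllPairs
  import Data.List.Relation.Unary.Unique.Propositional.Properties as Unique
  open import Data.List.Membership.Propositional using (_∈_)
  open import Data.List.Membership.Propositional.Properties
    using ( ∈-concat⁺′; ∈-concat⁻′; ∈-map⁺; ∈-map⁻; ∈-filter⁺; ∈-filter⁻; ∈-allFin
          ; ∈-applyUpTo⁺; ∈-applyUpTo⁻; ∈-tabulate⁺)
  import Data.List.Relation.Binary.Permutation.Propositional.Properties as Perm
  open import Data.List.Relation.Binary.BagAndSetEquality using (∼bag⇒↭)
  open import Data.List.Membership.Propositional.Properties.WithK using (unique∧set⇒bag)

  private
    n : ℕ
    n = suc n′

  -- A face (B₁,…,B_k ; σ₁,…,σ_k) is coded by the list of its coloured blocks Bᵢ, each given by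
  -- the blocks of the ordered set partition σᵢ in order, each of them listed increasingly.
  Code : Set
  Code = List (Block {n} {α})

  EndsInβ : Code → Set
  EndsInβ = Last ((_≡ β) ∘ proj₁)

  record IsFaceCode (B : Code) : Set where
    field
      nonEmpty          : NonEmptyBlocks B
      nonEmptySubBlocks : All (All NonEmpty ∘ proj₂) B
      increasing        : All (All Increasing ∘ proj₂) B
      alternating       : Alternating B
      unique            : Unique (blockElements B)
      complete          : ∀ x → x ∈ blockElements B

  _∈ᵇ_ : Fin n → List (Fin n) → Bool
  x ∈ᵇ l = does (Any.any? (x Fin.≟_) l)

  blockIndex : Fin n → Code → ℕ
  blockIndex x = findIndex (λ b → x ∈ᵇ concat (proj₂ b))

  subBlockIndex : Fin n → Code → ℕ
  subBlockIndex x B = findIndex (x ∈ᵇ_) (Maybe.maybe proj₂ [] (nth B (blockIndex x B)))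

  colourAt : Code → ℕ → Fin α
  colourAt B i = Maybe.maybe proj₁ β (nth B i)

  At : Code → ℕ → ℕ → Fin n → Set
  At B i j x = ∃₂ λ b sb → nth B i ≡ just b × nth (proj₂ b) j ≡ just sb × x ∈ sb

  At⇒indices : ∀ B {i j x} → Unique (blockElements B) → At B i j x →
    blockIndex x B ≡ i × subBlockIndex x B ≡ j
  At⇒indices B {i} {j} {x} u (b , sb , bᵢ , sbⱼ , x∈sb) = blockIndex≡ , subBlockIndex≡
    where
    elems : Block → List (Fin n)
    elems = concat ∘ proj₂
    nth-elems : ∀ i′ {b′} → nth B i′ ≡ just b′ → nth (map elems B) i′ ≡ just (elems b′)
    nth-elems i′ e = trans (nth-map elems B i′) (cong (Maybe.map elems) e)
    x∈b : x ∈ elems b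
    x∈b = ∈-concat⁺′ x∈sb (nth≡just⇒∈ (proj₂ b) j sbⱼ)
    blockIndex≡ : blockIndex x B ≡ i
    blockIndex≡ = findIndex-nth _ B i bᵢ (dec-true (Any.any? _ _) x∈b) λ i′ i′<i e →
      dec-false (Any.any? _ _) λ x∈ →
        ℕ.<-irrefl (Unique-concat-index (map elems B) u i′ i (nth-elems i′ e) (nth-elems i bᵢ) x∈ x∈b) i′<i
    unique-b : Unique (elems b)
    unique-b = Unique-concat⁻ (map elems B) u i (nth-elems i bᵢ)
    subBlockIndex≡ : subBlockIndex x B ≡ j
    subBlockIndex≡ rewrite blockIndex≡ | bᵢ =
      findIndex-nth _ (proj₂ b) j sbⱼ (dec-true (Any.any? _ _) x∈sb) λ j′ j′<j e →
        dec-false (Any.any? _ _) λ x∈ →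
          ℕ.<-irrefl (Unique-concat-index (proj₂ b) unique-b j′ j e sbⱼ x∈ x∈sb) j′<j

  ∈⇒At : ∀ B {x} → x ∈ blockElements B → ∃₂ λ i j → At B i j x
  ∈⇒At B x∈ with ∈-concat⁻′ (map (concat ∘ proj₂) B) x∈
  ... | _ , x∈b , b∈ with ∈-map⁻ (concat ∘ proj₂) b∈
  ...   | b , b∈B , refl with ∈-concat⁻′ (proj₂ b) x∈b
  ...     | sb , x∈sb , sb∈b =
    let i , bᵢ = ∈⇒nth≡just b∈B ; j , sbⱼ = ∈⇒nth≡just sb∈b in i , j , b , sb , bᵢ , sbⱼ , x∈sb

  module _ {k : ℕ} (blk : Vec (Fin k) n) (sub : Vec (Fin n) n) where

    InSubBlock? : (i : Fin k) (j : ℕ) (x : Fin n) → Dec (lookup blk x ≡ i × toℕ (lookup sub x) ≡ j)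
    InSubBlock? i j x = (lookup blk x Fin.≟ i) ×-dec (toℕ (lookup sub x) ℕ.≟ j)

    subBlock : Fin k → ℕ → List (Fin n)
    subBlock i j = filter (InSubBlock? i j) (allFin n)

    subBlock-increasing : ∀ i j → Increasing (subBlock i j)
    subBlock-increasing i j = AllPairs.filter⁺ (InSubBlock? i j) (allFin-increasing n)

    ∈-subBlock⁻ : ∀ {i j x} → x ∈ subBlock i j → lookup blk x ≡ i × toℕ (lookup sub x) ≡ j
    ∈-subBlock⁻ {i} {j} x∈ = proj₂ (∈-filter⁻ (InSubBlock? i j) {xs = allFin n} x∈)

    ∈-subBlock⁺ : ∀ {i j x} → lookup blk x ≡ i → toℕ (lookup sub x) ≡ j → x ∈ subBlock i j
    ∈-subBlock⁺ {i} {j} {x} blk≡ sub≡ = ∈-filter⁺ (InSubBlock? i j) (∈-allFin x) (blk≡ , sub≡)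

  codeOf : (k : ℕ) → Vec (Fin k) n → Vec (Fin α) k → Vec (Fin n) n → Code
  codeOf k blk col sub = List.tabulate λ i → lookup col i , applyUpTo (subBlock blk sub i) (subBlocks blk sub i)

  -- The indices are found by search and clamped into range; on a valid code no clamping occurs
  -- (At⇒i≤, At⇒j≤ below).
  module Decode (k₀ : ℕ) (B : Code) where

    blockOf : Fin n → Fin (suc k₀)
    blockOf x = clamp k₀ (blockIndex x B)

    subBlockOf : Fin n → Fin n
    subBlockOf x = clamp n′ (subBlockIndex x B)

    colourOf : Fin (suc k₀) → Fin α
    colourOf i = colourAt B (toℕ i)

    blk : Vec (Fin (suc k₀)) n
    blk = tabulate blockOf

    sub : Vec (Fin n) n
    sub = tabulate subBlockOf

    col : Vec (Fin α) (suc k₀)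
    col = tabulate colourOf

  module DecodeCorrect (k₀ : ℕ) (B : Code) (len : length B ≡ suc k₀) (v : IsFaceCode B) where

    open IsFaceCode v
    open Decode k₀ B public

    private
      k : ℕ
      k = suc k₀

    At⇒i≤ : ∀ {i j x} → At B i j x → i ≤ k₀
    At⇒i≤ {i} (_ , _ , bᵢ , _) = ℕ.≤-pred (subst (i <_) len (nth≡just⇒< B i bᵢ))

    At⇒j≤ : ∀ {i j x} → At B i j x → j ≤ n′
    At⇒j≤ {i} {j} (b , sb , bᵢ , sbⱼ , _) = ℕ.≤-pred (begin-strict
      j <⟨ nth≡just⇒< (proj₂ b) j sbⱼ ⟩
      length (proj₂ b)
        ≤⟨ length≤length-concat (proj₂ b) (All.lookup nonEmptySubBlocks (nth≡just⇒∈ B i bᵢ)) ⟩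
      length (concat (proj₂ b))
        ≤⟨ length-nth≤length-concat (map (concat ∘ proj₂) B) i
             (trans (nth-map _ B i) (cong (Maybe.map _) bᵢ)) ⟩
      length (blockElements B)
        ≤⟨ Unique⇒length≤ _ unique ⟩
      n ∎)
      where open ℕ.≤-Reasoning

    At⇒blk : ∀ {i j x} → At B i j x → toℕ (lookup blk x) ≡ i
    At⇒blk {i} {j} {x} a = begin
      toℕ (lookup blk x)              ≡⟨ cong toℕ (Vec.lookup∘tabulate blockOf x) ⟩
      toℕ (clamp k₀ (blockIndex x B)) ≡⟨ cong (toℕ ∘ clamp k₀) (proj₁ (At⇒indices B unique a)) ⟩
      toℕ (clamp k₀ i)                ≡⟨ toℕ-clamp k₀ (At⇒i≤ a) ⟩
      i                               ∎
      where open ≡-Reasoning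

    At⇒sub : ∀ {i j x} → At B i j x → toℕ (lookup sub x) ≡ j
    At⇒sub {i} {j} {x} a = begin
      toℕ (lookup sub x)                 ≡⟨ cong toℕ (Vec.lookup∘tabulate subBlockOf x) ⟩
      toℕ (clamp n′ (subBlockIndex x B)) ≡⟨ cong (toℕ ∘ clamp n′) (proj₂ (At⇒indices B unique a)) ⟩
      toℕ (clamp n′ j)                   ≡⟨ toℕ-clamp n′ (At⇒j≤ a) ⟩
      j                                  ∎
      where open ≡-Reasoning

    locate : ∀ x → ∃₂ λ i j → At B i j x
    locate x = ∈⇒At B (complete x)

    inhabit : ∀ {i j b sb} → nth B i ≡ just b → nth (proj₂ b) j ≡ just sb → ∃ λ z → At B i j z
    inhabit {i} {j} {b} {sb} bᵢ sbⱼ =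
      let z , z∈ = NonEmpty⇒∈ sb (All.lookup (All.lookup nonEmptySubBlocks (nth≡just⇒∈ B i bᵢ))
                                               (nth≡just⇒∈ (proj₂ b) j sbⱼ))
      in z , b , sb , bᵢ , sbⱼ , z∈

    nth-block : (i : Fin k) → ∃ λ b → nth B (toℕ i) ≡ just b
    nth-block i = nth-< B (subst (toℕ i <_) (sym len) (Fin.toℕ<n i))

    blk-surj : (i : Fin k) → ∃ λ x → lookup blk x ≡ i
    blk-surj i with nth-block i
    ... | b , bᵢ with proj₂ b in b≡ | All.lookup nonEmpty (nth≡just⇒∈ B _ bᵢ)
    ... | sb ∷ _ | _ =
      let z , a = inhabit {j = 0} bᵢ (cong (λ l → nth l 0) b≡) in z , Fin.toℕ-injective (At⇒blk a)

    lookup-col : ∀ (i : Fin k) {b} → nth B (toℕ i) ≡ just b → lookup col i ≡ proj₁ b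
    lookup-col i bᵢ = trans (Vec.lookup∘tabulate colourOf i) (cong (Maybe.maybe proj₁ β) bᵢ)

    col-alternating : (i j : Fin k) → toℕ j ≡ suc (toℕ i) → lookup col i ≢ lookup col j
    col-alternating i j j≡1+i col≡ with nth-block i | nth-block j
    ... | b , bᵢ | b′ , b′ⱼ =
      Linked-nth B (toℕ i) alternating bᵢ (subst (λ m → nth B m ≡ just b′) j≡1+i b′ⱼ)
        (trans (sym (lookup-col i bᵢ)) (trans col≡ (lookup-col j b′ⱼ)))

    col-last-β : EndsInβ B → (i : Fin k) → suc (toℕ i) ≡ k → lookup col i ≡ β
    col-last-β endsInβ i 1+i≡k with nth-block i
    ... | b , bᵢ = trans (lookup-col i bᵢ) (Last-nth B endsInβ (subst (λ m → nth B m ≡ just b) i≡k-1 bᵢ))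
      where
      i≡k-1 : toℕ i ≡ length B ∸ 1
      i≡k-1 = trans (ℕ.suc-injective 1+i≡k) (cong (_∸ 1) (sym len))

    sub-init : (y j : Fin n) → toℕ j < toℕ (lookup sub y) →
      ∃ λ z → lookup blk z ≡ lookup blk y × lookup sub z ≡ j
    sub-init y j j<sub with locate y
    ... | i , j′ , a@(b , _ , bᵢ , sbⱼ′ , _)
      with nth-< (proj₂ b) (ℕ.<-trans (subst (toℕ j <_) (At⇒sub a) j<sub) (nth≡just⇒< (proj₂ b) j′ sbⱼ′))
    ...   | sb , sbⱼ with inhabit bᵢ sbⱼ
    ...     | z , a′ =
      z , Fin.toℕ-injective (trans (At⇒blk a′) (sym (At⇒blk a))) , Fin.toℕ-injective (At⇒sub a′)

    locateIn : (i : Fin k) {b : Block} → nth B (toℕ i) ≡ just b → ∀ {x} → lookup blk x ≡ i →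
      ∃₂ λ j sb → nth (proj₂ b) j ≡ just sb × x ∈ sb × toℕ (lookup sub x) ≡ j
    locateIn i bᵢ {x} blk≡ with locate x
    ... | _ , j , a@(_ , sb , b′ᵢ , sbⱼ , x∈) with trans (sym (At⇒blk a)) (cong toℕ blk≡)
    ...   | refl with trans (sym bᵢ) b′ᵢ
    ...     | refl = j , sb , sbⱼ , x∈ , At⇒sub a

    blk≡⇒∈ : (i : Fin k) {b : Block} → nth B (toℕ i) ≡ just b →
      ∀ {x} → lookup blk x ≡ i → x ∈ concat (proj₂ b)
    blk≡⇒∈ i {b} bᵢ blk≡ =
      let j , _ , sbⱼ , x∈ , _ = locateIn i bᵢ blk≡ in ∈-concat⁺′ x∈ (nth≡just⇒∈ (proj₂ b) j sbⱼ)

    ∈⇒blk≡ : (i : Fin k) {b : Block} → nth B (toℕ i) ≡ just b →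
      ∀ {x} → x ∈ concat (proj₂ b) → lookup blk x ≡ i
    ∈⇒blk≡ i {b} bᵢ x∈ with ∈-concat⁻′ (proj₂ b) x∈
    ... | sb , x∈sb , sb∈ =
      let j , sbⱼ = ∈⇒nth≡just sb∈ in Fin.toℕ-injective (At⇒blk (b , sb , bᵢ , sbⱼ , x∈sb))

    blockSize≡ : (i : Fin k) {b : Block} → nth B (toℕ i) ≡ just b →
      blockSize blk i ≡ length (concat (proj₂ b))
    blockSize≡ i {b} bᵢ = Perm.↭-length (∼bag⇒↭ (unique∧set⇒bag unique-filter unique-b (mk⇔ ⊆b b⊆)))
      where
      P? : ∀ x → Dec (lookup blk x ≡ i)
      P? x = lookup blk x Fin.≟ i
      unique-filter : Unique (filter P? (allFin n))
      unique-filter = Unique.filter⁺ P? {xs = allFin n} (Unique.allFin⁺ n)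
      unique-b : Unique (concat (proj₂ b))
      unique-b = Unique-concat⁻ (map (concat ∘ proj₂) B) unique (toℕ i)
                   (trans (nth-map _ B (toℕ i)) (cong (Maybe.map _) bᵢ))
      ⊆b : ∀ {x} → x ∈ filter P? (allFin n) → x ∈ concat (proj₂ b)
      ⊆b x∈ = blk≡⇒∈ i bᵢ (proj₂ (∈-filter⁻ P? {xs = allFin n} x∈))
      b⊆ : ∀ {x} → x ∈ concat (proj₂ b) → x ∈ filter P? (allFin n)
      b⊆ {x} x∈ = ∈-filter⁺ P? (∈-allFin x) (∈⇒blk≡ i bᵢ x∈)

    subBlocks≡ : (i : Fin k) {b : Block} → nth B (toℕ i) ≡ just b →
      subBlocks blk sub i ≡ length (proj₂ b)
    subBlocks≡ i {b} bᵢ = ℕ.≤-antisym (maxOver-≤ P g (allFin n) (λ x _ → g≤ x ∘ ⌊⌋≡true⇒ (P? x))) ≤max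
      where
      P? : ∀ x → Dec (lookup blk x ≡ i)
      P? x = lookup blk x Fin.≟ i
      P : Fin n → Bool
      P x = ⌊ P? x ⌋
      g : Fin n → ℕ
      g x = suc (toℕ (lookup sub x))
      g≤ : ∀ x → lookup blk x ≡ i → g x ≤ length (proj₂ b)
      g≤ x blk≡ = let j , _ , sbⱼ , _ , sub≡ = locateIn i bᵢ {x} blk≡ in
        subst (λ t → suc t ≤ _) (sym sub≡) (nth≡just⇒< (proj₂ b) j sbⱼ)
      ≤max : length (proj₂ b) ≤ maxOver P g (allFin n)
      ≤max with proj₂ b in b≡ | All.lookup nonEmpty (nth≡just⇒∈ B _ bᵢ)
      ... | s ∷ ss | _ with nth-< (s ∷ ss) {length ss} ℕ.≤-refl
      ...   | sb , sb-last with inhabit bᵢ (trans (cong (λ l → nth l (length ss)) b≡) sb-last)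
      ...     | z , a = subst (_≤ maxOver P g (allFin n)) (cong suc (At⇒sub a))
                          (≤-maxOver P g (allFin n) (∈-allFin z)
                            (⌊⌋≡true⁺ (P? z) (Fin.toℕ-injective (At⇒blk a))))

    faceDim≡ : faceDim blk sub ≡ blockDimension B
    faceDim≡ = cong Σℕ (trans (List.map-tabulate (λ i → i) _)
      (tabulate≡map B len _ _ (λ i bᵢ → cong₂ _∸_ (blockSize≡ i bᵢ) (subBlocks≡ i bᵢ))))

    subBlock≡ : (i : Fin k) {b : Block} → nth B (toℕ i) ≡ just b →
      ∀ j {sb} → nth (proj₂ b) j ≡ just sb → subBlock blk sub i j ≡ sb
    subBlock≡ i {b} bᵢ j {sb} sbⱼ = Increasing-≡ (subBlock-increasing blk sub i j)
      (All.lookup (All.lookup increasing (nth≡just⇒∈ B _ bᵢ)) (nth≡just⇒∈ (proj₂ b) j sbⱼ)) ⊆sb sb⊆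
      where
      ⊆sb : ∀ {x} → x ∈ subBlock blk sub i j → x ∈ sb
      ⊆sb x∈ with ∈-subBlock⁻ blk sub x∈
      ... | blk≡ , refl with locateIn i bᵢ blk≡
      ...   | _ , _ , sb′ⱼ , x∈sb′ , refl with trans (sym sbⱼ) sb′ⱼ
      ...     | refl = x∈sb′
      sb⊆ : ∀ {x} → x ∈ sb → x ∈ subBlock blk sub i j
      sb⊆ x∈ = let a = b , sb , bᵢ , sbⱼ , x∈ in
        ∈-subBlock⁺ blk sub (Fin.toℕ-injective (At⇒blk a)) (At⇒sub a)

    codeOf-decode : codeOf k blk col sub ≡ B
    codeOf-decode = trans (tabulate≡map B len _ (λ b → b) entry) (List.map-id B)
      where
      entry : ∀ i {b} → nth B (toℕ i) ≡ just b →
        (lookup col i , applyUpTo (subBlock blk sub i) (subBlocks blk sub i)) ≡ b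
      entry i {b} bᵢ = cong₂ _,_ (lookup-col i bᵢ) (begin
        applyUpTo (subBlock blk sub i) (subBlocks blk sub i)
          ≡⟨ cong (applyUpTo (subBlock blk sub i)) (subBlocks≡ i bᵢ) ⟩
        applyUpTo (subBlock blk sub i) (length (proj₂ b))
          ≡⟨ applyUpTo-length≡ (proj₂ b) _ (subBlock≡ i bᵢ) ⟩
        proj₂ b ∎)
        where open ≡-Reasoning

  IsFaceCode⇒length≢0 : ∀ B → length B ≡ 0 → IsFaceCode B → ⊥
  IsFaceCode⇒length≢0 [] _ v with IsFaceCode.complete v Fin.zero
  ... | ()

  decode : (k : ℕ) (B : Code) → .(length B ≡ k) → .(IsFaceCode B) → .(EndsInβ B) →
    Face n α β (blockDimension B)
  decode zero     B len v endsInβ = Irrelevant.⊥-elim (IsFaceCode⇒length≢0 B len v)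
  decode (suc k₀) B len v endsInβ = record
    { k           = suc k₀
    ; blk         = blk
    ; col         = col
    ; sub         = sub
    ; blk-surj    = DecodeCorrect.blk-surj k₀ B len v
    ; alternating = DecodeCorrect.col-alternating k₀ B len v
    ; last-β      = DecodeCorrect.col-last-β k₀ B len v endsInβ
    ; sub-init    = DecodeCorrect.sub-init k₀ B len v
    ; dim         = DecodeCorrect.faceDim≡ k₀ B len v
    }
    where open Decode k₀ B

  -- The properties of a face are irrelevant fields; being decidable, they can be recomputed.
  module _ {k : ℕ} where

    surjective? : (blk : Vec (Fin k) n) → Dec (∀ i → ∃ λ x → lookup blk x ≡ i)
    surjective? blk = Fin.all? λ i → Fin.any? λ x → lookup blk x Fin.≟ i

    subInit? : (blk : Vec (Fin k) n) (sub : Vec (Fin n) n) →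
      Dec ((y j : Fin n) → toℕ j < toℕ (lookup sub y) → ∃ λ z → lookup blk z ≡ lookup blk y × lookup sub z ≡ j)
    subInit? blk sub = Fin.all? λ y → Fin.all? λ j → (toℕ j ℕ.<? toℕ (lookup sub y)) →-dec
      Fin.any? λ z → (lookup blk z Fin.≟ lookup blk y) ×-dec (lookup sub z Fin.≟ j)

    alternating? : (col : Vec (Fin α) k) →
      Dec ((i j : Fin k) → toℕ j ≡ suc (toℕ i) → lookup col i ≢ lookup col j)
    alternating? col = Fin.all? λ i → Fin.all? λ j →
      (toℕ j ℕ.≟ suc (toℕ i)) →-dec ¬? (lookup col i Fin.≟ lookup col j)

    lastβ? : (col : Vec (Fin α) k) → Dec ((i : Fin k) → suc (toℕ i) ≡ k → lookup col i ≡ β)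
    lastβ? col = Fin.all? λ i → (suc (toℕ i) ℕ.≟ k) →-dec (lookup col i Fin.≟ β)

  module EncodeCorrect (k₀ : ℕ) (blk : Vec (Fin (suc k₀)) n) (col : Vec (Fin α) (suc k₀)) (sub : Vec (Fin n) n)
    .(blk-surj : (i : Fin (suc k₀)) → ∃ λ x → lookup blk x ≡ i)
    .(sub-init : (y j : Fin n) → toℕ j < toℕ (lookup sub y) → ∃ λ z → lookup blk z ≡ lookup blk y × lookup sub z ≡ j)
    .(alternating : (i j : Fin (suc k₀)) → toℕ j ≡ suc (toℕ i) → lookup col i ≢ lookup col j) where

    private
      k : ℕ
      k = suc k₀

      surj : (i : Fin k) → ∃ λ x → lookup blk x ≡ i
      surj = recompute (surjective? blk) blk-surj

      init : (y j : Fin n) → toℕ j < toℕ (lookup sub y) → ∃ λ z → lookup blk z ≡ lookup blk y × lookup sub z ≡ j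
      init = recompute (subInit? blk sub) sub-init

      alt : (i j : Fin k) → toℕ j ≡ suc (toℕ i) → lookup col i ≢ lookup col j
      alt = recompute (alternating? col) alternating

    m : Fin k → ℕ
    m = subBlocks blk sub

    entry : Fin k → Block
    entry i = lookup col i , applyUpTo (subBlock blk sub i) (m i)

    code : Code
    code = codeOf k blk col sub

    sub<m : ∀ x → toℕ (lookup sub x) < m (lookup blk x)
    sub<m x = ≤-maxOver (λ y → ⌊ lookup blk y Fin.≟ lookup blk x ⌋) (λ y → suc (toℕ (lookup sub y)))
                (allFin n) (∈-allFin x) (⌊⌋≡true⁺ (lookup blk x Fin.≟ lookup blk x) refl)

    At-code : ∀ x → At code (toℕ (lookup blk x)) (toℕ (lookup sub x)) x
    At-code x = entry (lookup blk x) , subBlock blk sub (lookup blk x) (toℕ (lookup sub x)) ,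
                nth-tabulate entry (lookup blk x) , nth-applyUpTo (subBlock blk sub (lookup blk x)) (sub<m x) ,
                ∈-subBlock⁺ blk sub refl refl

    -- The index m i - 1 is attained by some y in block i; smaller indices are attained by sub-init.
    subBlock-nonEmpty : ∀ i {j} → j < m i → NonEmpty (subBlock blk sub i j)
    subBlock-nonEmpty i {j} j<m
      with maxOver-attained (λ y → ⌊ lookup blk y Fin.≟ i ⌋) (λ y → suc (toℕ (lookup sub y))) (allFin n)
    ... | inj₁ m≡0 = ⊥-elim (ℕ.n≮0 (subst (j <_) m≡0 j<m))
    ... | inj₂ (y , _ , py , gy) with ⌊⌋≡true⇒ (lookup blk y Fin.≟ i) py
    ...   | refl with ℕ.m≤n⇒m<n∨m≡n (ℕ.≤-pred (subst (j <_) (sym gy) j<m))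
    ...     | inj₂ refl = ∈⇒NonEmpty (∈-subBlock⁺ blk sub {x = y} refl refl)
    ...     | inj₁ j<sub with init y (Fin.fromℕ< (ℕ.<-trans j<sub (Fin.toℕ<n (lookup sub y))))
                                      (subst (_< toℕ (lookup sub y)) (sym (Fin.toℕ-fromℕ< _)) j<sub)
    ...       | z , blk≡ , sub≡ =
      ∈⇒NonEmpty (∈-subBlock⁺ blk sub blk≡ (trans (cong toℕ sub≡) (Fin.toℕ-fromℕ< _)))

    entry-nonEmpty : ∀ i → NonEmpty (proj₂ (entry i))
    entry-nonEmpty i with surj i
    ... | x , refl with m (lookup blk x) | sub<m x
    ...   | suc _ | _ = _

    entry-unique : ∀ i → Unique (concat (proj₂ (entry i)))
    entry-unique i = Unique.concat⁺
      (All.applyUpTo⁺₂ (subBlock blk sub i) (m i) (Increasing⇒Unique ∘ subBlock-increasing blk sub i))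
      (AllPairs.applyUpTo⁺₁ (subBlock blk sub i) (m i) λ j<j′ _ (x∈₁ , x∈₂) →
        ℕ.<-irrefl (trans (sym (proj₂ (∈-subBlock⁻ blk sub x∈₁))) (proj₂ (∈-subBlock⁻ blk sub x∈₂))) j<j′)

    ∈-entry⁻ : ∀ {i x} → x ∈ concat (proj₂ (entry i)) → lookup blk x ≡ i
    ∈-entry⁻ {i} x∈ with ∈-concat⁻′ (applyUpTo (subBlock blk sub i) (m i)) x∈
    ... | _ , x∈sb , sb∈ with ∈-applyUpTo⁻ (subBlock blk sub i) sb∈
    ...   | _ , _ , refl = proj₁ (∈-subBlock⁻ blk sub x∈sb)

    isFaceCode : IsFaceCode code
    isFaceCode = record
      { nonEmpty          = All.tabulate⁺ {f = entry} entry-nonEmpty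
      ; nonEmptySubBlocks = All.tabulate⁺ {f = entry} λ i →
                              All.applyUpTo⁺₁ (subBlock blk sub i) (m i) (subBlock-nonEmpty i)
      ; increasing        = All.tabulate⁺ {f = entry} λ i →
                              All.applyUpTo⁺₂ (subBlock blk sub i) (m i) (subBlock-increasing blk sub i)
      ; alternating       = Linked-tabulate⁺ entry alt
      ; unique            = Unique.concat⁺ (All.map⁺ (All.tabulate⁺ {f = entry} entry-unique))
                              (AllPairs.map⁺ (AllPairs.tabulate⁺ {f = entry} λ i≢i′ (x∈₁ , x∈₂) →
                                i≢i′ (trans (sym (∈-entry⁻ x∈₁)) (∈-entry⁻ x∈₂))))
      ; complete          = complete
      }
      where
      complete : ∀ x → x ∈ blockElements code
      complete x = ∈-concat⁺′
        (∈-concat⁺′ (∈-subBlock⁺ blk sub {j = toℕ (lookup sub x)} refl refl)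
                    (∈-applyUpTo⁺ (subBlock blk sub (lookup blk x)) (sub<m x)))
        (∈-map⁺ (concat ∘ proj₂) (∈-tabulate⁺ {f = entry} (lookup blk x)))

    endsInβ : (∀ i → suc (toℕ i) ≡ k → lookup col i ≡ β) → EndsInβ code
    endsInβ = Last-tabulate⁺ entry

    length-code : length code ≡ k
    length-code = List.length-tabulate entry

    private
      module D = DecodeCorrect k₀ code length-code isFaceCode

    blk-decode : D.blk ≡ blk
    blk-decode = trans (Vec.tabulate-cong λ x →
        trans (cong (clamp k₀) (proj₁ (At⇒indices code (IsFaceCode.unique isFaceCode) (At-code x))))
              (clamp-toℕ k₀ (lookup blk x)))
      (Vec.tabulate∘lookup blk)

    sub-decode : D.sub ≡ sub
    sub-decode = trans (Vec.tabulate-cong λ x →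
        trans (cong (clamp n′) (proj₂ (At⇒indices code {i = toℕ (lookup blk x)}
                                       (IsFaceCode.unique isFaceCode) (At-code x))))
              (clamp-toℕ n′ (lookup sub x)))
      (Vec.tabulate∘lookup sub)

    col-decode : D.col ≡ col
    col-decode = trans (Vec.tabulate-cong λ i → cong (Maybe.maybe proj₁ β) (nth-tabulate entry i))
                       (Vec.tabulate∘lookup col)

    blockDimension≡ : blockDimension code ≡ faceDim blk sub
    blockDimension≡ = trans (sym D.faceDim≡) (cong₂ faceDim blk-decode sub-decode)

  encode : ∀ {d} → Face n α β d → Code
  encode F = codeOf (Face.k F) (Face.blk F) (Face.col F) (Face.sub F)

  length-encode : ∀ {d} (F : Face n α β d) → length (encode F) ≡ Face.k F
  length-encode F = List.length-tabulate _

  encode-decode : ∀ k B (len : length B ≡ k) (v : IsFaceCode B) .{v′ e} → encode (decode k B len v′ e) ≡ B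
  encode-decode zero     B len v = ⊥-elim (IsFaceCode⇒length≢0 B len v)
  encode-decode (suc k₀) B len v = DecodeCorrect.codeOf-decode k₀ B len v

  encode-valid : ∀ {d} (F : Face n α β d) → IsFaceCode (encode F) × EndsInβ (encode F)
  encode-valid record { k = zero ; blk = blk } with lookup blk Fin.zero
  ... | ()
  encode-valid record { k = suc k₀ ; blk = blk ; col = col ; sub = sub
                      ; blk-surj = surj ; alternating = alt ; last-β = last ; sub-init = init } =
    E.isFaceCode , E.endsInβ (recompute (lastβ? col) last)
    where module E = EncodeCorrect k₀ blk col sub surj init alt

  decode-encode : ∀ {d} (F : Face n α β d) .(len : length (encode F) ≡ Face.k F)
    .(v : IsFaceCode (encode F)) .(e : EndsInβ (encode F)) →
    _≡_ {A = Σ ℕ (Face n α β)} (blockDimension (encode F) , decode (Face.k F) (encode F) len v e) (d , F)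
  decode-encode record { k = zero ; blk = blk } len v e with lookup blk Fin.zero
  ... | ()
  decode-encode {d} record { k = suc k₀ ; blk = blk ; col = col ; sub = sub
                           ; blk-surj = surj ; alternating = alt ; sub-init = init ; dim = dim } len v e =
    face-≡ (trans E.blockDimension≡ (recompute (faceDim blk sub ℕ.≟ d) dim))
           E.blk-decode E.col-decode E.sub-decode
    where
    module E = EncodeCorrect k₀ blk col sub surj init alt
    face-≡ : ∀ {k d d′} {b b′ : Vec (Fin k) n} {c c′ : Vec (Fin α) k} {s s′ : Vec (Fin n) n}
      .{p₁ p₂ p₃ p₄ p₅ q₁ q₂ q₃ q₄ q₅} → d ≡ d′ → b ≡ b′ → c ≡ c′ → s ≡ s′ →
      _≡_ {A = Σ ℕ (Face n α β)}
        (d  , record { k = k ; blk = b  ; col = c  ; sub = s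
                     ; blk-surj = p₁ ; alternating = p₂ ; last-β = p₃ ; sub-init = p₄ ; dim = p₅ })
        (d′ , record { k = k ; blk = b′ ; col = c′ ; sub = s′
                     ; blk-surj = q₁ ; alternating = q₂ ; last-β = q₃ ; sub-init = q₄ ; dim = q₅ })
    face-≡ refl refl refl refl = refl

module Bijection (n′ α : ℕ) (β : Fin α) where

  open import Defs using (Face; ColPerm)
  open Lists
  open Gluings
  open ColouredWords
  open Pieces
  open Blocks
  open import Data.Nat using (ℕ; suc)
  open import Data.List as List using (List; map; length)
  import Data.List.Properties as List
  open import Data.Fin using (Fin)
  open import Data.Bool using (Bool)
  open import Data.Product using (Σ; _×_; _,_; proj₁; proj₂)
  open import Function using (_∘_)
  open import Relation.Binary.PropositionalEquality
  open import Data.List.Relation.Unary.Unique.Propositional using (Unique)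
  open import Data.List.Membership.Propositional using (_∈_)

  open FaceCodes n′ α β
  open Counting n′ α β using (FaceGluingBijection; IsGluingOf)

  private
    n : ℕ
    n = suc n′

  module FromCode (B : Code) (v : IsFaceCode B) where

    open IsFaceCode v

    pieces : List Piece
    pieces = ungroup B

    positions≡ : map proj₁ (lettersOf pieces) ≡ blockElements B
    positions≡ = trans (map-proj₁-lettersOf pieces) (elements-ungroup B)

    lettersOf-unique : Unique (map proj₁ (lettersOf pieces))
    lettersOf-unique = subst Unique (sym positions≡) unique

    length-lettersOf : length (lettersOf pieces) ≡ n
    length-lettersOf = begin
      length (lettersOf pieces)             ≡⟨ List.length-map proj₁ (lettersOf pieces) ⟨
      length (map proj₁ (lettersOf pieces)) ≡⟨ cong length positions≡ ⟩
      length (blockElements B)              ≡⟨ Unique∧complete⇒length≡ (blockElements B) unique complete ⟩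
      n                                     ∎
      where open ≡-Reasoning

    pieces-nonEmpty : NonEmptyPieces pieces
    pieces-nonEmpty = All-ungroup⁺ B nonEmptySubBlocks

    lettersOf-last : EndsInβ B → Last ((_≡ β) ∘ proj₂) (lettersOf pieces)
    lettersOf-last e = Last-lettersOf⁺ (_≡ β) pieces pieces-nonEmpty (Last-ungroup⁺ (_≡ β) B nonEmpty e)

  gluingOfCode : (B : Code) → .(IsFaceCode B) → .(EndsInβ B) → ColPerm n α β × List Bool
  gluingOfCode B v e =
    fromLetters (lettersOf (ungroup B)) (length-lettersOf B v) (lettersOf-unique B v) (lettersOf-last B v e) ,
    gluingOf (ungroup B)
    where open FromCode

  gluingOfCode-cong : ∀ {B B′} → B ≡ B′ → ∀ .{v v′ e e′} →
    gluingOfCode B v e ≡ gluingOfCode B′ v′ e′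
  gluingOfCode-cong refl = refl

  toGluing : Σ ℕ (Face n α β) → ColPerm n α β × List Bool
  toGluing (_ , F) = gluingOfCode (encode F) (proj₁ (encode-valid F)) (proj₂ (encode-valid F))

  toGluing-valid : ∀ F → IsGluingOf (toGluing F)
  toGluing-valid (_ , F) = subst (λ L → Gluing L (gluingOf pieces))
      (sym (letters-fromLetters (lettersOf pieces) length-lettersOf lettersOf-unique (lettersOf-last e)))
      (lettersOf-Gluing pieces pieces-nonEmpty (All-ungroup⁺ (encode F) (IsFaceCode.increasing v)))
    where
    v : IsFaceCode (encode F)
    v = proj₁ (encode-valid F)
    e : EndsInβ (encode F)
    e = proj₂ (encode-valid F)
    open FromCode (encode F) v

  toGluing-dim : ∀ F → trues (proj₂ (toGluing F)) ≡ proj₁ F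
  toGluing-dim (d , F) = begin
    trues (gluingOf (ungroup B)) ≡⟨ trues-gluingOf (ungroup B) ⟩
    dimension (ungroup B)        ≡⟨ dimension-ungroup B (IsFaceCode.nonEmptySubBlocks v) ⟩
    blockDimension B             ≡⟨ cong proj₁ (decode-encode F (length-encode F) v (proj₂ (encode-valid F))) ⟩
    d                            ∎
    where
    open ≡-Reasoning
    B : Code
    B = encode F
    v : IsFaceCode B
    v = proj₁ (encode-valid F)

  module FromGluing (τ : ColPerm n α β) (S : List Bool) where

    pieces : List Piece
    pieces = cutAt (letters τ) S

    code : Code
    code = group pieces

    module _ (g : Gluing (letters τ) S) where

      blockElements≡ : blockElements code ≡ map proj₁ (letters τ)
      blockElements≡ = trans (blockElements-group pieces)
        (trans (sym (map-proj₁-lettersOf pieces)) (cong (map proj₁) (proj₁ (cutAt-inverse g))))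

      code-valid : IsFaceCode code
      code-valid = record
        { nonEmpty          = group-nonEmpty pieces
        ; nonEmptySubBlocks = All-ungroup⁻ code
            (subst NonEmptyPieces (sym (ungroup-group pieces)) (cutAt-nonEmpty (letters τ) S))
        ; increasing        = All-ungroup⁻ code
            (subst IncreasingPieces (sym (ungroup-group pieces)) (cutAt-increasing g (letters-unique τ)))
        ; alternating       = group-alternating pieces
        ; unique            = subst Unique (sym blockElements≡) (letters-unique τ)
        ; complete          = λ x → subst (x ∈_) (sym blockElements≡)
            (Unique∧length≡⇒complete (map proj₁ (letters τ)) (letters-unique τ)
              (trans (List.length-map proj₁ (letters τ)) (length-letters τ)) x)
        }

      code-endsInβ : EndsInβ code
      code-endsInβ = Last-ungroup⁻ (_≡ β) code (group-nonEmpty pieces)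
        (subst (Last _) (sym (ungroup-group pieces))
          (Last-lettersOf⁻ (_≡ β) pieces (cutAt-nonEmpty (letters τ) S)
            (subst (Last _) (sym (proj₁ (cutAt-inverse g))) (letters-last τ))))

  fromGluing : (t : ColPerm n α β × List Bool) → .(IsGluingOf t) → Σ ℕ (Face n α β)
  fromGluing (τ , S) g = blockDimension code , decode (length code) code refl (code-valid g) (code-endsInβ g)
    where open FromGluing τ S

  decode-cong : ∀ {k k′ : ℕ} {B B′ : Code} → k ≡ k′ → B ≡ B′ → ∀ .{len len′ v v′ e e′} →
    _≡_ {A = Σ ℕ (Face n α β)} (blockDimension B , decode k B len v e)
                               (blockDimension B′ , decode k′ B′ len′ v′ e′)
  decode-cong refl refl = refl

  from∘to : ∀ F → fromGluing (toGluing F) (toGluing-valid F) ≡ F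
  from∘to (d , F) = trans (decode-cong (trans (cong length regroup) (length-encode F)) regroup)
                          (decode-encode F (length-encode F) v (proj₂ (encode-valid F)))
    where
    B : Code
    B = encode F
    v : IsFaceCode B
    v = proj₁ (encode-valid F)
    open FromCode B v
    regroup : FromGluing.code (proj₁ (toGluing (d , F))) (gluingOf pieces) ≡ B
    regroup = begin
      group (cutAt (letters (proj₁ (toGluing (d , F)))) (gluingOf pieces))
        ≡⟨ cong (λ L → group (cutAt L (gluingOf pieces)))
                (letters-fromLetters (lettersOf pieces) length-lettersOf lettersOf-unique
                                     (lettersOf-last (proj₂ (encode-valid F)))) ⟩
      group (cutAt (lettersOf pieces) (gluingOf pieces))
        ≡⟨ cong group (cutAt-lettersOf pieces pieces-nonEmpty) ⟩
      group (ungroup B)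
        ≡⟨ group-ungroup B (IsFaceCode.alternating v) (IsFaceCode.nonEmpty v) ⟩
      B ∎
      where open ≡-Reasoning

  to∘from : ∀ t (g : IsGluingOf t) → toGluing (fromGluing t g) ≡ t
  to∘from (τ , S) g = trans
    (gluingOfCode-cong (encode-decode (length code) code refl v)
      {v = proj₁ (encode-valid F)} {v′ = v} {e = proj₂ (encode-valid F)} {e′ = e})
    (cong₂ _,_ (trans (fromLetters-cong lettersOf≡
                         {len = length-lettersOf} {len′ = length-letters τ}
                         {u = lettersOf-unique} {u′ = letters-unique τ}
                         {lb = lettersOf-last e} {lb′ = letters-last τ})
                      (fromLetters-letters τ {len = length-letters τ} {u = letters-unique τ} {lb = letters-last τ}))
               gluingOf≡)
    where
    open FromGluing τ S
    v : IsFaceCode code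
    v = code-valid g
    e : EndsInβ code
    e = code-endsInβ g
    F : Face n α β (blockDimension code)
    F = decode (length code) code refl v e
    open FromCode code v using (length-lettersOf; lettersOf-unique; lettersOf-last)
    lettersOf≡ : lettersOf (ungroup code) ≡ letters τ
    lettersOf≡ = trans (cong lettersOf (ungroup-group pieces)) (proj₁ (cutAt-inverse g))
    gluingOf≡ : gluingOf (ungroup code) ≡ S
    gluingOf≡ = trans (cong gluingOf (ungroup-group pieces)) (proj₂ (cutAt-inverse g))

  faceGluingBijection : FaceGluingBijection
  faceGluingBijection = record
    { toGluing       = toGluing
    ; toGluing-valid = toGluing-valid
    ; toGluing-dim   = toGluing-dim
    ; fromGluing     = fromGluing
    ; from∘to        = from∘to
    ; to∘from        = to∘from
    }

open import Data.Nat using (suc)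
open import Data.List.Properties using (map-cong)
open import Data.Product using (proj₁; proj₂)
open import Function using (_∘_)
open import Relation.Binary.PropositionalEquality using (cong; module ≡-Reasoning)
import Data.List.Relation.Binary.Permutation.Propositional.Properties as Perm
open IntegerSums using (Σℤ-map-∘; Σℤ-↭)
open Gluings using (weight)

theorem6p4 : (n α : ℕ) (β : Fin α) → 1 ≤ n → 1 ≤ α →
    (f : ℕ → ℕ) → ((d : ℕ) → Fin (f d) ↔ Face n α β d) →
    (N : ℕ) (e : Fin N ↔ ColPerm n α β) →
    (x : ℤ) →
    eulerianPoly n f x ≡ Σℤ (map (λ i → x ^ des (Inverse.to e i)) (allFin N))
theorem6p4 (suc n′) α β _ _ f faces N perms x = begin
  eulerianPoly (suc n′) f x
    ≡⟨ eulerianPoly≡Σ-faces x ⟩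
  Σℤ (map (faceTerm x ∘ proj₁) allFaces)
    ≡⟨ cong Σℤ (map-cong (faceTerm≡weight x) allFaces) ⟩
  Σℤ (map (weight x ∘ proj₂ ∘ toGluing) allFaces)
    ≡⟨ Σℤ-map-∘ (weight x ∘ proj₂) toGluing allFaces ⟨
  Σℤ (map (weight x ∘ proj₂) (map toGluing allFaces))
    ≡⟨ Σℤ-↭ (Perm.map⁺ (weight x ∘ proj₂) map-toGluing-↭) ⟩
  Σℤ (map (weight x ∘ proj₂) allGluings)
    ≡⟨ Σ-gluings≡Σ-des x ⟩
  Σℤ (map (λ i → x ^ des (Inverse.to perms i)) (allFin N)) ∎
  where
  open ≡-Reasoning
  open Bijection n′ α β using (faceGluingBijection; toGluing)
  open Counting n′ α β
  open Enumerated faceGluingBijection f faces N perms
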